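{- Let $\Box F:=\,?!F$ and $\Diamond F:=\neg\Box\neg F$ (classical $\neg$) for c-formulas $F$. For a formula $A$ of QHC, let $A_\Diamond$ be obtained from $A$ by prefixing every classical connective and quantifier, every atomic c-formula, and every occurrence of $?$ with $\Box\Diamond$. Precisely: - $(p(x_1,\dots,x_n))_\Diamond=\Box\Diamond p(x_1,\dots,x_n)$; - $(F\circ G)_\Diamond=\Box\Diamond(F_\Diamond\circ G_\Diamond)$ for each classical binary connective $\circ$; - $(\neg F)_\Diamond=\Box\Diamond\neg F_\Diamond$; - $(\exists x\,F)_\Diamond=\Box\Diamond\exists x\,F_\Diamond$ and $(\forall x\,F)_\Diamond=\Box\Diamond\forall x\,F_\Diamond$; - $(?\Phi)_\Diamond=\Box\Diamond ?\Phi_\Diamond$; - all other constructors (the constants, atomic i-formulas, intuitionistic connectives and quantifiers, and $!$) are left unchanged and applied to the translated subformulas. If $A_1,\dots,A_n,A$ are formulas of QHC with $A_1,\dots,A_n\vdash_{QHC}A$, then $(A_1)_\Diamond,\dots,(A_n)_\Diamond\vdash_{QHC}A_\Diamond$. Moreover, if $A$ is a formula of QC (a c-formula with no $?$ and no $!$), then $\vdash_{QHC}A_\Diamond$ implies $\vdash_{QHC}A$.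
   Context: Meta-logical framework. Formulas of a first-order language may contain individual variables and predicate variables. Meta-formulas are built from formulas using meta-conjunction $\&$, meta-implication $\Rightarrow$, and universal meta-quantifiers over individual and predicate variables. A principle $\cdot G$, for a formula $G$, is the meta-formula obtained by universally meta-quantifying all free individual variables of $G$ and then all predicate variables of $G$. A rule $F_1,\dots,F_m/G$ is the meta-formula $\forall^2(\forall^1F_1\,\&\cdots\&\,\forall^1F_m\Rightarrow\forall^1G)$, where $\forall^1$ meta-quantifies the free individual variables of the formula it precedes and $\forall^2$ meta-quantifies all predicate variables occurring. A logic $L$ is given by a derivation system $\mathcal D$, a meta-conjunction of finitely many principles and rules. For a meta-formula $\mathcal F$, $\vdash_L\mathcal F$ means that $\mathcal D\Rightarrow\mathcal F$ is derivable by the natural-deduction meta-rules: introduction and elimination of $\&$, $\Rightarrow$ and the universal meta-quantifiers (elimination allows substituting terms for individual variables and formulas for predicate variables), plus $\alpha$-conversion. The notation $\mathcal F_1,\dots,\mathcal F_m\vdash_L\mathcal G$ means $\vdash_L(\mathcal F_1\&\cdots\&\mathcal F_m)\Rightarrow\mathcal G$. A formula by itself is a meta-formula, with its free variables not generalized. Language of QHC. It has individual variables and, for each $n\ge0$, countably many $n$-ary problem variables $\alpha,\beta,\gamma,\delta,\theta,\dots$ and countably many $n$-ary proper predicate variables $p,q,\dots$. - A c-formula is $\top$, $\bot$, an atom $p(x_1,\dots,x_n)$, or $?\Phi$ for an i-formula $\Phi$, closed under the classical connectives $\land,\lor,\to,\leftrightarrow,\neg$ and quantifiers $\exists,\forall$.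 - An i-formula is $\checkmark$ (triviality), $\curlywedge$ (absurdity), an atom $\alpha(x_1,\dots,x_n)$, or $!F$ for a c-formula $F$, closed under the intuitionistic connectives $\land,\lor,\to,\leftrightarrow,\neg$ (with $\neg\Phi:=\Phi\to\curlywedge$) and quantifiers $\exists,\forall$. Connectives applied to c-formulas are classical; those applied to i-formulas are intuitionistic. QHC is the logic whose derivation system consists of: - (0a) all laws and rules of classical predicate logic QC, for c-formulas; - (0b) all laws and rules of intuitionistic predicate logic QH, for i-formulas; - the principles $\cdot\,?(\gamma\land\delta)\leftrightarrow ?\gamma\land ?\delta$, $\cdot\,?(\gamma\lor\delta)\leftrightarrow ?\gamma\lor ?\delta$, $\cdot\,?(\gamma\to\delta)\to(?\gamma\to ?\delta)$, $\cdot\,\neg ?\curlywedge$, $\cdot\,?\exists x\,\theta(x)\leftrightarrow\exists x\,?\theta(x)$, $\cdot\,?\forall x\,\theta(x)\to\forall x\,?\theta(x)$, $\cdot\,\gamma\to\,!?\gamma$, $\cdot\,\neg !\bot$, $\cdot\,?!p\to p$, $\cdot\,!p\to\,!?!p$ and $\cdot\,!(p\to q)\to(!p\to !q)$; - the rules $!p/p$ and $p/!p$. -}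

module Defs where

-- Individual and predicate variables are de Bruijn indices (so α-conversion
-- is built in and substitution is capture-avoiding).

open import Data.Nat using (ℕ; zero; suc; _+_)
open import Data.Fin using (Fin; zero; suc; _↑ˡ_; _↑ʳ_; splitAt)
open import Data.Vec using (Vec; []; _∷_; tabulate; lookup)
import Data.Vec as Vec
open import Data.List using (List; []; _∷_)
import Data.List as List
open import Data.List.Membership.Propositional using (_∈_)
open import Data.Product using (Σ; _,_; _×_)
open import Data.Sum using (_⊎_; inj₁; inj₂)

-- Sorts: C = c-formulas (propositions, classical), I = i-formulas (problems)

data Sort : Set where
  C I : Sort

-- A predicate variable is described by its sort and its arity:
--   (C , n) : n-ary proper predicate variable  p, q, ...
--   (I , n) : n-ary problem variable           α, β, γ, ...
PVar : Set
PVar = Sort × ℕ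

PCtx : Set
PCtx = List PVar

data _∋_ : PCtx → PVar → Set where
  here  : ∀ {Δ x} → (x ∷ Δ) ∋ x
  there : ∀ {Δ x y} → Δ ∋ x → (y ∷ Δ) ∋ x

data BinOp : Set where
  conj disj impl equiv : BinOp

-- Formulas. Fm s Δ n : formulas of sort s with predicate variables from Δ
-- and free individual variables among n de Bruijn indices.
-- Terms are individual variables only.

data Fm : Sort → PCtx → ℕ → Set where
  ⊤ᶜ ⊥ᶜ : ∀ {Δ n} → Fm C Δ n
  ✓ ⋏   : ∀ {Δ n} → Fm I Δ n
  atom  : ∀ {s Δ n k} → Δ ∋ (s , k) → Vec (Fin n) k → Fm s Δ n
  ¿_    : ∀ {Δ n} → Fm I Δ n → Fm C Δ n
  ¡_    : ∀ {Δ n} → Fm C Δ n → Fm I Δ n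
  bin   : ∀ {s Δ n} → BinOp → Fm s Δ n → Fm s Δ n → Fm s Δ n
        -- classical connective on sort C, intuitionistic one on sort I
  ¬ᶜ_   : ∀ {Δ n} → Fm C Δ n → Fm C Δ n
  all ex : ∀ {s Δ n} → Fm s Δ (suc n) → Fm s Δ n

infixr 30 ¿_ ¡_ ¬ᶜ_

_∧'_ _∨'_ _⊃_ _⇔'_ : ∀ {s Δ n} → Fm s Δ n → Fm s Δ n → Fm s Δ n
A ∧' B = bin conj A B
A ∨' B = bin disj A B
A ⊃ B = bin impl A B
A ⇔' B = bin equiv A B
infixr 25 _∧'_ _∨'_
infixr 20 _⊃_ _⇔'_

¬ⁱ_ : ∀ {Δ n} → Fm I Δ n → Fm I Δ n
¬ⁱ A = A ⊃ ⋏
infixr 30 ¬ⁱ_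

AnyFm : PCtx → ℕ → Set
AnyFm Δ n = Σ Sort (λ s → Fm s Δ n)

liftR : ∀ {n m} → (Fin n → Fin m) → Fin (suc n) → Fin (suc m)
liftR ρ zero = zero
liftR ρ (suc x) = suc (ρ x)

ren : ∀ {s Δ n m} → (Fin n → Fin m) → Fm s Δ n → Fm s Δ m
ren ρ ⊤ᶜ = ⊤ᶜ
ren ρ ⊥ᶜ = ⊥ᶜ
ren ρ ✓ = ✓
ren ρ ⋏ = ⋏
ren ρ (atom x ts) = atom x (Vec.map ρ ts)
ren ρ (¿ A) = ¿ ren ρ A
ren ρ (¡ A) = ¡ ren ρ A
ren ρ (bin o A B) = bin o (ren ρ A) (ren ρ B)
ren ρ (¬ᶜ A) = ¬ᶜ ren ρ A
ren ρ (all A) = all (ren (liftR ρ) A)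
ren ρ (ex A) = ex (ren (liftR ρ) A)

PRen : PCtx → PCtx → Set
PRen Δ Δ' = ∀ {x} → Δ ∋ x → Δ' ∋ x

liftPR : ∀ {Δ Δ' y} → PRen Δ Δ' → PRen (y ∷ Δ) (y ∷ Δ')
liftPR ρ here = here
liftPR ρ (there x) = there (ρ x)

pren : ∀ {s Δ Δ' n} → PRen Δ Δ' → Fm s Δ n → Fm s Δ' n
pren ρ ⊤ᶜ = ⊤ᶜ
pren ρ ⊥ᶜ = ⊥ᶜ
pren ρ ✓ = ✓
pren ρ ⋏ = ⋏
pren ρ (atom x ts) = atom (ρ x) ts
pren ρ (¿ A) = ¿ pren ρ A
pren ρ (¡ A) = ¡ pren ρ A
pren ρ (bin o A B) = bin o (pren ρ A) (pren ρ B)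
pren ρ (¬ᶜ A) = ¬ᶜ pren ρ A
pren ρ (all A) = all (pren ρ A)
pren ρ (ex A) = ex (pren ρ A)

-- A k-ary predicate variable is replaced by a formula over k + n individual
-- variables; the first k (i ↑ˡ n) are the argument places, the remaining n
-- (k ↑ʳ j) are the ambient free variables.

PSub : PCtx → PCtx → ℕ → Set
PSub Δ Δ' n = ∀ {s k} → Δ ∋ (s , k) → Fm s Δ' (k + n)

wkArgs : ∀ k {n} → Fin (k + n) → Fin (k + suc n)
wkArgs k {n} i with splitAt k i
... | inj₁ a = a ↑ˡ suc n
... | inj₂ b = k ↑ʳ suc b

liftPS : ∀ {Δ Δ' n} → PSub Δ Δ' n → PSub Δ Δ' (suc n)
liftPS σ {s} {k} x = ren (wkArgs k) (σ x)

inst : ∀ {k n} → Vec (Fin n) k → Fin (k + n) → Fin n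
inst {k} ts i with splitAt k i
... | inj₁ a = lookup ts a
... | inj₂ b = b

psub : ∀ {s Δ Δ' n} → PSub Δ Δ' n → Fm s Δ n → Fm s Δ' n
psub σ ⊤ᶜ = ⊤ᶜ
psub σ ⊥ᶜ = ⊥ᶜ
psub σ ✓ = ✓
psub σ ⋏ = ⋏
psub σ (atom x ts) = ren (inst ts) (σ x)
psub σ (¿ A) = ¿ psub σ A
psub σ (¡ A) = ¡ psub σ A
psub σ (bin o A B) = bin o (psub σ A) (psub σ B)
psub σ (¬ᶜ A) = ¬ᶜ psub σ A
psub σ (all A) = all (psub (liftPS σ) A)
psub σ (ex A) = ex (psub (liftPS σ) A)

-- the atom P(first k variables), i.e. the identity substitution for P
idAtom : ∀ {s Δ n k} → Δ ∋ (s , k) → Fm s Δ (k + n)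
idAtom {n = n} x = atom x (tabulate (λ j → j ↑ˡ n))

liftPSp : ∀ {Δ Δ' n y} → PSub Δ Δ' n → PSub (y ∷ Δ) (y ∷ Δ') n
liftPSp σ here = idAtom here
liftPSp σ (there x) = pren there (σ x)

sub0 : ∀ {s k Δ n} → Fm s Δ (k + n) → PSub ((s , k) ∷ Δ) Δ n
sub0 Φ here = Φ
sub0 Φ (there x) = idAtom x

data MF : PCtx → ℕ → Set where
  fm  : ∀ {s Δ n} → Fm s Δ n → MF Δ n
  _&_ : ∀ {Δ n} → MF Δ n → MF Δ n → MF Δ n
  _⇒_ : ∀ {Δ n} → MF Δ n → MF Δ n → MF Δ n
  Πi  : ∀ {Δ n} → MF Δ (suc n) → MF Δ n
  Πp  : ∀ {Δ n} s k → MF ((s , k) ∷ Δ) n → MF Δ n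

infixr 15 _&_
infixr 10 _⇒_

renM : ∀ {Δ n m} → (Fin n → Fin m) → MF Δ n → MF Δ m
renM ρ (fm A) = fm (ren ρ A)
renM ρ (M & N) = renM ρ M & renM ρ N
renM ρ (M ⇒ N) = renM ρ M ⇒ renM ρ N
renM ρ (Πi M) = Πi (renM (liftR ρ) M)
renM ρ (Πp s k M) = Πp s k (renM ρ M)

prenM : ∀ {Δ Δ' n} → PRen Δ Δ' → MF Δ n → MF Δ' n
prenM ρ (fm A) = fm (pren ρ A)
prenM ρ (M & N) = prenM ρ M & prenM ρ N
prenM ρ (M ⇒ N) = prenM ρ M ⇒ prenM ρ N
prenM ρ (Πi M) = Πi (prenM ρ M)
prenM ρ (Πp s k M) = Πp s k (prenM (liftPR ρ) M)

psubM : ∀ {Δ Δ' n} → PSub Δ Δ' n → MF Δ n → MF Δ' n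
psubM σ (fm A) = fm (psub σ A)
psubM σ (M & N) = psubM σ M & psubM σ N
psubM σ (M ⇒ N) = psubM σ M ⇒ psubM σ N
psubM σ (Πi M) = Πi (psubM (liftPS σ) M)
psubM σ (Πp s k M) = Πp s k (psubM (liftPSp σ) M)

sub0i : ∀ {n} → Fin n → Fin (suc n) → Fin n
sub0i t zero = t
sub0i t (suc x) = x

data Deriv : ∀ {Δ n} → List (MF Δ n) → MF Δ n → Set where
  hyp  : ∀ {Δ n} {Γ : List (MF Δ n)} {M} → M ∈ Γ → Deriv Γ M
  &I   : ∀ {Δ n} {Γ : List (MF Δ n)} {M N} → Deriv Γ M → Deriv Γ N → Deriv Γ (M & N)
  &E₁  : ∀ {Δ n} {Γ : List (MF Δ n)} {M N} → Deriv Γ (M & N) → Deriv Γ M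
  &E₂  : ∀ {Δ n} {Γ : List (MF Δ n)} {M N} → Deriv Γ (M & N) → Deriv Γ N
  ⇒I   : ∀ {Δ n} {Γ : List (MF Δ n)} {M N} → Deriv (M ∷ Γ) N → Deriv Γ (M ⇒ N)
  ⇒E   : ∀ {Δ n} {Γ : List (MF Δ n)} {M N} → Deriv Γ (M ⇒ N) → Deriv Γ M → Deriv Γ N
  ΠiI  : ∀ {Δ n} {Γ : List (MF Δ n)} {M} →
         Deriv (List.map (renM suc) Γ) M → Deriv Γ (Πi M)
  ΠiE  : ∀ {Δ n} {Γ : List (MF Δ n)} {M} →
         Deriv Γ (Πi M) → (t : Fin n) → Deriv Γ (renM (sub0i t) M)
  ΠpI  : ∀ {Δ n s k} {Γ : List (MF Δ n)} {M} →
         Deriv (List.map (prenM there) Γ) M → Deriv Γ (Πp s k M)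
  ΠpE  : ∀ {Δ n s k} {Γ : List (MF Δ n)} {M} →
         Deriv Γ (Πp s k M) → (Φ : Fm s Δ (k + n)) → Deriv Γ (psubM (sub0 Φ) M)

#0 : ∀ {s Δ n} → Fm s ((s , 0) ∷ Δ) n
#0 = atom here []
#1 : ∀ {s y Δ n} → Fm s (y ∷ (s , 0) ∷ Δ) n
#1 = atom (there here) []
#2 : ∀ {s y z Δ n} → Fm s (y ∷ z ∷ (s , 0) ∷ Δ) n
#2 = atom (there (there here)) []

θ : ∀ {s Δ n} → Fin n → Fm s ((s , 1) ∷ Δ) n
θ x = atom here (x ∷ [])

⊤ₛ ⊥ₛ : ∀ s {Δ n} → Fm s Δ n
⊤ₛ C = ⊤ᶜ
⊤ₛ I = ✓
⊥ₛ C = ⊥ᶜ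
⊥ₛ I = ⋏

Π1 Π2 Π3 : ∀ {Δ n} s → _
Π1 {Δ} {n} s = λ (M : MF ((s , 0) ∷ Δ) n) → Πp s 0 M
Π2 {Δ} {n} s = λ (M : MF ((s , 0) ∷ (s , 0) ∷ Δ) n) → Πp s 0 (Πp s 0 M)
Π3 {Δ} {n} s = λ (M : MF ((s , 0) ∷ (s , 0) ∷ (s , 0) ∷ Δ) n) → Πp s 0 (Πp s 0 (Πp s 0 M))

-- A standard Hilbert-style axiomatization of intuitionistic predicate logic,
-- as principles and rules of the meta-language, for formulas of sort s
-- (QH for s = I; for s = C it is completed to QC below).
-- Conventions: p = #2/#1, q = #1/#0, r = #0; θ a unary predicate variable.
intAxioms : ∀ {Δ n} → Sort → List (MF Δ n)
intAxioms s =
    Π2 s (fm (#1 ⊃ (#0 ⊃ #1)))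
  ∷ Π3 s (fm ((#2 ⊃ (#1 ⊃ #0)) ⊃ ((#2 ⊃ #1) ⊃ (#2 ⊃ #0))))
  ∷ Π2 s (fm ((#1 ∧' #0) ⊃ #1))
  ∷ Π2 s (fm ((#1 ∧' #0) ⊃ #0))
  ∷ Π2 s (fm (#1 ⊃ (#0 ⊃ (#1 ∧' #0))))
  ∷ Π2 s (fm (#1 ⊃ (#1 ∨' #0)))
  ∷ Π2 s (fm (#0 ⊃ (#1 ∨' #0)))
  ∷ Π3 s (fm ((#2 ⊃ #0) ⊃ ((#1 ⊃ #0) ⊃ ((#2 ∨' #1) ⊃ #0))))
  ∷ Π1 s (fm (⊥ₛ s ⊃ #0))
  ∷ fm (⊤ₛ s)
  ∷ Π2 s (fm ((#1 ⇔' #0) ⊃ (#1 ⊃ #0)))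
  ∷ Π2 s (fm ((#1 ⇔' #0) ⊃ (#0 ⊃ #1)))
  ∷ Π2 s (fm ((#1 ⊃ #0) ⊃ ((#0 ⊃ #1) ⊃ (#1 ⇔' #0))))
  ∷ Π2 s ((fm #1 & fm (#1 ⊃ #0)) ⇒ fm #0)
  ∷ Πp s 1 (Πi (fm (all (θ zero) ⊃ θ zero)))
  ∷ Πp s 1 (Πi (fm (θ zero ⊃ ex (θ zero))))
  ∷ Πp s 0 (Πp s 1 (Πi (fm (atom (there here) [] ⊃ θ zero))
                     ⇒ fm (atom (there here) [] ⊃ all (θ zero))))
  ∷ Πp s 0 (Πp s 1 (Πi (fm (θ zero ⊃ atom (there here) []))
                     ⇒ fm (ex (θ zero) ⊃ atom (there here) [])))
  ∷ []

-- extra principles making the C-part classical (with primitive ¬)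
classAxioms : ∀ {Δ n} → List (MF Δ n)
classAxioms =
    Π1 C (fm (¬ᶜ ¬ᶜ #0 ⊃ #0))
  ∷ Π1 C (fm (¬ᶜ #0 ⊃ (#0 ⊃ ⊥ᶜ)))
  ∷ Π1 C (fm ((#0 ⊃ ⊥ᶜ) ⊃ ¬ᶜ #0))
  ∷ []

-- the specific principles and rules of QHC
-- (γ, δ: 0-ary problem variables; θ: unary problem variable;
--  p, q: 0-ary proper predicate variables)
qhcAxioms : ∀ {Δ n} → List (MF Δ n)
qhcAxioms =
    Π2 I (fm (¿ (#1 ∧' #0) ⇔' (¿ #1 ∧' ¿ #0)))
  ∷ Π2 I (fm (¿ (#1 ∨' #0) ⇔' (¿ #1 ∨' ¿ #0)))
  ∷ Π2 I (fm (¿ (#1 ⊃ #0) ⊃ (¿ #1 ⊃ ¿ #0)))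
  ∷ fm (¬ᶜ ¿ ⋏)
  ∷ Πp I 1 (fm (¿ ex (θ zero) ⇔' ex (¿ θ zero)))
  ∷ Πp I 1 (fm (¿ all (θ zero) ⊃ all (¿ θ zero)))
  ∷ Π1 I (fm (#0 ⊃ ¡ ¿ #0))
  ∷ fm (¬ⁱ ¡ ⊥ᶜ)
  ∷ Π1 C (fm (¿ ¡ #0 ⊃ #0))
  ∷ Π1 C (fm (¡ #0 ⊃ ¡ ¿ ¡ #0))
  ∷ Π2 C (fm (¡ (#1 ⊃ #0) ⊃ (¡ #1 ⊃ ¡ #0)))
  ∷ Π1 C (fm (¡ #0) ⇒ fm #0)
  ∷ Π1 C (fm #0 ⇒ fm (¡ #0))
  ∷ []

⋀ : ∀ {Δ n} → MF Δ n → List (MF Δ n) → MF Δ n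
⋀ M [] = M
⋀ M (N ∷ Ns) = M & ⋀ N Ns

𝒟 : ∀ {Δ n} → MF Δ n
𝒟 = ⋀ (fm ⊤ᶜ) (intAxioms I List.++ intAxioms C List.++ classAxioms List.++ qhcAxioms)

-- ⊢_QHC M  :⇔  𝒟 ⇒ M is derivable
⊢ᴰ : ∀ {Δ n} → MF Δ n → Set
⊢ᴰ M = Deriv [] (𝒟 ⇒ M)

fmΣ : ∀ {Δ n} → AnyFm Δ n → MF Δ n
fmΣ (s , A) = fm A

-- A₁, …, Aₖ ⊢_QHC A  :⇔  ⊢_QHC (A₁ & … & Aₖ) ⇒ A   (just ⊢_QHC A when k = 0)
_⊢QHC_ : ∀ {Δ n s} → List (AnyFm Δ n) → Fm s Δ n → Set
[] ⊢QHC A = ⊢ᴰ (fm A)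
(B ∷ Bs) ⊢QHC A = ⊢ᴰ (⋀ (fmΣ B) (List.map fmΣ Bs) ⇒ fm A)

Box Dia BoxDia : ∀ {Δ n} → Fm C Δ n → Fm C Δ n
Box F = ¿ ¡ F
Dia F = ¬ᶜ Box (¬ᶜ F)
BoxDia F = Box (Dia F)

_◇ : ∀ {s Δ n} → Fm s Δ n → Fm s Δ n
⊤ᶜ ◇ = ⊤ᶜ
⊥ᶜ ◇ = ⊥ᶜ
✓ ◇ = ✓
⋏ ◇ = ⋏
atom {C} x ts ◇ = BoxDia (atom x ts)
atom {I} x ts ◇ = atom x ts
(¿ Φ) ◇ = BoxDia (¿ (Φ ◇))
(¡ F) ◇ = ¡ (F ◇)
bin {C} o A B ◇ = BoxDia (bin o (A ◇) (B ◇))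
bin {I} o A B ◇ = bin o (A ◇) (B ◇)
(¬ᶜ A) ◇ = BoxDia (¬ᶜ (A ◇))
all {C} A ◇ = BoxDia (all (A ◇))
all {I} A ◇ = all (A ◇)
ex {C} A ◇ = BoxDia (ex (A ◇))
ex {I} A ◇ = ex (A ◇)

◇Σ : ∀ {Δ n} → AnyFm Δ n → AnyFm Δ n
◇Σ (s , A) = s , (A ◇)

data IsQC : ∀ {Δ n} → Fm C Δ n → Set where
  ⊤ᶜ   : ∀ {Δ n} → IsQC {Δ} {n} ⊤ᶜ
  ⊥ᶜ   : ∀ {Δ n} → IsQC {Δ} {n} ⊥ᶜ
  atom : ∀ {Δ n k} (x : Δ ∋ (C , k)) (ts : Vec (Fin n) k) → IsQC (atom x ts)
  bin  : ∀ {Δ n} o {A B : Fm C Δ n} → IsQC A → IsQC B → IsQC (bin o A B)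
  ¬ᶜ_  : ∀ {Δ n} {A : Fm C Δ n} → IsQC A → IsQC (¬ᶜ A)
  all  : ∀ {Δ n} {A : Fm C Δ (suc n)} → IsQC A → IsQC (all A)
  ex   : ∀ {Δ n} {A : Fm C Δ (suc n)} → IsQC A → IsQC (ex A)

-- Extend ◇ homomorphically to meta-formulas. A derivation then translates rule by rule into a
-- derivation from 𝒟 and the translated hypotheses: all natural-deduction rules commute with ◇
-- except the instantiation of a predicate variable, where substitution and ◇ agree only up to
-- provable equivalence, because translated c-formulas are stable: □◇(F◇) ⇔ F◇. It remains to derive
-- the translation of 𝒟 from 𝒟. Problem axioms are unchanged; for the classical ones, □ = ?! is an
-- S4 modality, translated c-formulas are persistent (X ⊃ □X), and on persistent formulas □◇ acts
-- like a monad, which is enough to validate the translated laws of QC.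
--
-- Conversely, erasing ?, ! and the problem variables (the latter to ⊤) maps derivations to
-- derivations and 𝒟 to consequences of its classical part; as □◇ erases to ¬¬, the erasure of A◇
-- is classically equivalent to A when A is a formula of QC.

module Submission where

open import Defs
open import Function using (id; _∘_)
open import Data.Nat using (ℕ; zero; suc; _+_)
open import Data.Fin using (Fin; zero; suc; _↑ˡ_; splitAt)
open import Data.Fin.Properties using (splitAt-↑ˡ)
open import Data.Vec using (Vec; []; _∷_; tabulate; lookup)
import Data.Vec as Vec
import Data.Vec.Properties as Vecₚ
open import Data.List using (List; []; _∷_; map; _++_)
import Data.List.Properties as Listₚ
open import Data.List.Relation.Unary.All using (All; []; _∷_)
open import Data.List.Relation.Unary.Any using (here; there)
open import Data.List.Membership.Propositional using (_∈_)
open import Data.List.Membership.Propositional.Properties using (∈-map⁺)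
open import Data.List.Relation.Binary.Subset.Propositional using (_⊆_)
open import Data.List.Relation.Binary.Subset.Propositional.Properties
  using (map⁺; ∷⁺ʳ; xs⊆x∷xs; ⊆-reflexive-↭)
open import Data.List.Relation.Binary.Permutation.Propositional using (↭-swap; ↭-refl)
open import Data.Maybe using (Maybe; just; nothing)
import Data.Maybe as Maybe
open import Data.Product using (_,_; _×_; proj₁; proj₂)
open import Data.Sum using (inj₁)
open import Relation.Binary.PropositionalEquality

liftR-∘ : ∀ {n m l} {ρ : Fin m → Fin l} {ρ' : Fin n → Fin m} {τ : Fin n → Fin l} →
          ρ ∘ ρ' ≗ τ → liftR ρ ∘ liftR ρ' ≗ liftR τ
liftR-∘ eq zero    = refl
liftR-∘ eq (suc i) = cong suc (eq i)

ren-∘ : ∀ {s Δ n m l} {ρ : Fin m → Fin l} {ρ' : Fin n → Fin m} {τ : Fin n → Fin l} →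
        ρ ∘ ρ' ≗ τ → (A : Fm s Δ n) → ren ρ (ren ρ' A) ≡ ren τ A
ren-∘ eq ⊤ᶜ          = refl
ren-∘ eq ⊥ᶜ          = refl
ren-∘ eq ✓           = refl
ren-∘ eq ⋏           = refl
ren-∘ {ρ = ρ} {ρ'} eq (atom x ts) =
  cong (atom x) (trans (sym (Vecₚ.map-∘ ρ ρ' ts)) (Vecₚ.map-cong eq ts))
ren-∘ eq (¿ A)       = cong ¿_ (ren-∘ eq A)
ren-∘ eq (¡ A)       = cong ¡_ (ren-∘ eq A)
ren-∘ eq (bin o A B) = cong₂ (bin o) (ren-∘ eq A) (ren-∘ eq B)
ren-∘ eq (¬ᶜ A)      = cong ¬ᶜ_ (ren-∘ eq A)
ren-∘ eq (all A)     = cong all (ren-∘ (liftR-∘ eq) A)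
ren-∘ eq (ex A)      = cong ex (ren-∘ (liftR-∘ eq) A)

liftR-id : ∀ {n} {ρ : Fin n → Fin n} → ρ ≗ id → liftR ρ ≗ id
liftR-id eq zero    = refl
liftR-id eq (suc i) = cong suc (eq i)

ren-id : ∀ {s Δ n} {ρ : Fin n → Fin n} → ρ ≗ id → (A : Fm s Δ n) → ren ρ A ≡ A
ren-id eq ⊤ᶜ          = refl
ren-id eq ⊥ᶜ          = refl
ren-id eq ✓           = refl
ren-id eq ⋏           = refl
ren-id eq (atom x ts) = cong (atom x) (trans (Vecₚ.map-cong eq ts) (Vecₚ.map-id ts))
ren-id eq (¿ A)       = cong ¿_ (ren-id eq A)
ren-id eq (¡ A)       = cong ¡_ (ren-id eq A)
ren-id eq (bin o A B) = cong₂ (bin o) (ren-id eq A) (ren-id eq B)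
ren-id eq (¬ᶜ A)      = cong ¬ᶜ_ (ren-id eq A)
ren-id eq (all A)     = cong all (ren-id (liftR-id eq) A)
ren-id eq (ex A)      = cong ex (ren-id (liftR-id eq) A)

ren-∘-id : ∀ {s Δ n m} {ρ : Fin m → Fin n} {ρ' : Fin n → Fin m} →
           ρ ∘ ρ' ≗ id → (A : Fm s Δ n) → ren ρ (ren ρ' A) ≡ A
ren-∘-id eq A = trans (ren-∘ eq A) (ren-id (λ _ → refl) A)

ren-∘₃ : ∀ {s Δ n m k l} {a : Fin k → Fin l} {b : Fin m → Fin k} {c : Fin n → Fin m}
         {d : Fin n → Fin l} → a ∘ b ∘ c ≗ d → (A : Fm s Δ n) → ren a (ren b (ren c A)) ≡ ren d A
ren-∘₃ {a = a} eq A = trans (cong (ren a) (ren-∘ (λ _ → refl) A)) (ren-∘ eq A)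

ren-inst[] : ∀ {s Δ n} (A : Fm s Δ n) → ren (inst []) A ≡ A
ren-inst[] = ren-id (λ _ → refl)

ren-pren : ∀ {s Δ Δ' n m} (ρ : Fin n → Fin m) (π : PRen Δ Δ') (A : Fm s Δ n) →
           ren ρ (pren π A) ≡ pren π (ren ρ A)
ren-pren ρ π ⊤ᶜ          = refl
ren-pren ρ π ⊥ᶜ          = refl
ren-pren ρ π ✓           = refl
ren-pren ρ π ⋏           = refl
ren-pren ρ π (atom x ts) = refl
ren-pren ρ π (¿ A)       = cong ¿_ (ren-pren ρ π A)
ren-pren ρ π (¡ A)       = cong ¡_ (ren-pren ρ π A)
ren-pren ρ π (bin o A B) = cong₂ (bin o) (ren-pren ρ π A) (ren-pren ρ π B)
ren-pren ρ π (¬ᶜ A)      = cong ¬ᶜ_ (ren-pren ρ π A)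
ren-pren ρ π (all A)     = cong all (ren-pren (liftR ρ) π A)
ren-pren ρ π (ex A)      = cong ex (ren-pren (liftR ρ) π A)

pren-∘ : ∀ {s Δ Δ' Δ'' n} {π : PRen Δ' Δ''} {π' : PRen Δ Δ'} {π'' : PRen Δ Δ''} →
         (∀ {x} (v : Δ ∋ x) → π (π' v) ≡ π'' v) → (A : Fm s Δ n) → pren π (pren π' A) ≡ pren π'' A
pren-∘ eq ⊤ᶜ          = refl
pren-∘ eq ⊥ᶜ          = refl
pren-∘ eq ✓           = refl
pren-∘ eq ⋏           = refl
pren-∘ eq (atom x ts) = cong (λ y → atom y ts) (eq x)
pren-∘ eq (¿ A)       = cong ¿_ (pren-∘ eq A)
pren-∘ eq (¡ A)       = cong ¡_ (pren-∘ eq A)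
pren-∘ eq (bin o A B) = cong₂ (bin o) (pren-∘ eq A) (pren-∘ eq B)
pren-∘ eq (¬ᶜ A)      = cong ¬ᶜ_ (pren-∘ eq A)
pren-∘ eq (all A)     = cong all (pren-∘ eq A)
pren-∘ eq (ex A)      = cong ex (pren-∘ eq A)

pren-id : ∀ {s Δ n} {π : PRen Δ Δ} → (∀ {x} (v : Δ ∋ x) → π v ≡ v) → (A : Fm s Δ n) → pren π A ≡ A
pren-id eq ⊤ᶜ          = refl
pren-id eq ⊥ᶜ          = refl
pren-id eq ✓           = refl
pren-id eq ⋏           = refl
pren-id eq (atom x ts) = cong (λ y → atom y ts) (eq x)
pren-id eq (¿ A)       = cong ¿_ (pren-id eq A)
pren-id eq (¡ A)       = cong ¡_ (pren-id eq A)
pren-id eq (bin o A B) = cong₂ (bin o) (pren-id eq A) (pren-id eq B)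
pren-id eq (¬ᶜ A)      = cong ¬ᶜ_ (pren-id eq A)
pren-id eq (all A)     = cong all (pren-id eq A)
pren-id eq (ex A)      = cong ex (pren-id eq A)

psub-cong : ∀ {s Δ Δ' n} {σ σ' : PSub Δ Δ' n} → (∀ {s k} (x : Δ ∋ (s , k)) → σ x ≡ σ' x) →
            (A : Fm s Δ n) → psub σ A ≡ psub σ' A
psub-cong eq ⊤ᶜ          = refl
psub-cong eq ⊥ᶜ          = refl
psub-cong eq ✓           = refl
psub-cong eq ⋏           = refl
psub-cong eq (atom x ts) = cong (ren (inst ts)) (eq x)
psub-cong eq (¿ A)       = cong ¿_ (psub-cong eq A)
psub-cong eq (¡ A)       = cong ¡_ (psub-cong eq A)
psub-cong eq (bin o A B) = cong₂ (bin o) (psub-cong eq A) (psub-cong eq B)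
psub-cong eq (¬ᶜ A)      = cong ¬ᶜ_ (psub-cong eq A)
psub-cong eq (all A)     = cong all (psub-cong (λ {_} {k} x → cong (ren (wkArgs k)) (eq x)) A)
psub-cong eq (ex A)      = cong ex (psub-cong (λ {_} {k} x → cong (ren (wkArgs k)) (eq x)) A)

psub-pren : ∀ {s Δ Δ' Δ'' n} (σ : PSub Δ' Δ'' n) (π : PRen Δ Δ') (A : Fm s Δ n) →
            psub σ (pren π A) ≡ psub (σ ∘ π) A
psub-pren σ π ⊤ᶜ          = refl
psub-pren σ π ⊥ᶜ          = refl
psub-pren σ π ✓           = refl
psub-pren σ π ⋏           = refl
psub-pren σ π (atom x ts) = refl
psub-pren σ π (¿ A)       = cong ¿_ (psub-pren σ π A)
psub-pren σ π (¡ A)       = cong ¡_ (psub-pren σ π A)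
psub-pren σ π (bin o A B) = cong₂ (bin o) (psub-pren σ π A) (psub-pren σ π B)
psub-pren σ π (¬ᶜ A)      = cong ¬ᶜ_ (psub-pren σ π A)
psub-pren σ π (all A)     = cong all (psub-pren (liftPS σ) π A)
psub-pren σ π (ex A)      = cong ex (psub-pren (liftPS σ) π A)

inst-↑ˡ : ∀ {k n} (ts : Vec (Fin n) k) (j : Fin k) → inst ts (j ↑ˡ n) ≡ lookup ts j
inst-↑ˡ {k} {n} ts j with splitAt k (j ↑ˡ n) | splitAt-↑ˡ k j n
... | .(inj₁ j) | refl = refl

wkArgs-↑ˡ : ∀ k {n} (j : Fin k) → wkArgs k {n} (j ↑ˡ n) ≡ j ↑ˡ suc n
wkArgs-↑ˡ k {n} j with splitAt k (j ↑ˡ n) | splitAt-↑ˡ k j n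
... | .(inj₁ j) | refl = refl

inst-idAtom : ∀ {s Δ n k} (x : Δ ∋ (s , k)) (ts : Vec (Fin n) k) →
              ren (inst ts) (idAtom {n = n} x) ≡ atom x ts
inst-idAtom {n = n} x ts = cong (atom x) (begin
  Vec.map (inst ts) (tabulate (_↑ˡ n)) ≡⟨ sym (Vecₚ.tabulate-∘ (inst ts) (_↑ˡ n)) ⟩
  tabulate (inst ts ∘ (_↑ˡ n))         ≡⟨ Vecₚ.tabulate-cong (inst-↑ˡ ts) ⟩
  tabulate (lookup ts)                 ≡⟨ Vecₚ.tabulate∘lookup ts ⟩
  ts                                   ∎)
  where open ≡-Reasoning

wkArgs-idAtom : ∀ {s Δ n k} (x : Δ ∋ (s , k)) →
                ren (wkArgs k) (idAtom {n = n} x) ≡ idAtom {n = suc n} x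
wkArgs-idAtom {n = n} {k} x = cong (atom x)
  (trans (sym (Vecₚ.tabulate-∘ (wkArgs k) (_↑ˡ n))) (Vecₚ.tabulate-cong (wkArgs-↑ˡ k)))

psub-idAtom : ∀ {s Δ Δ' n} {σ : PSub Δ Δ' n} {π : PRen Δ Δ'} →
              (∀ {s k} (x : Δ ∋ (s , k)) → σ x ≡ idAtom (π x)) → (A : Fm s Δ n) → psub σ A ≡ pren π A
psub-idAtom eq ⊤ᶜ          = refl
psub-idAtom eq ⊥ᶜ          = refl
psub-idAtom eq ✓           = refl
psub-idAtom eq ⋏           = refl
psub-idAtom {π = π} eq (atom x ts) = trans (cong (ren (inst ts)) (eq x)) (inst-idAtom (π x) ts)
psub-idAtom eq (¿ A)       = cong ¿_ (psub-idAtom eq A)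
psub-idAtom eq (¡ A)       = cong ¡_ (psub-idAtom eq A)
psub-idAtom eq (bin o A B) = cong₂ (bin o) (psub-idAtom eq A) (psub-idAtom eq B)
psub-idAtom eq (¬ᶜ A)      = cong ¬ᶜ_ (psub-idAtom eq A)
psub-idAtom {π = π} eq (all A) =
  cong all (psub-idAtom (λ {_} {k} x → trans (cong (ren (wkArgs k)) (eq x)) (wkArgs-idAtom (π x))) A)
psub-idAtom {π = π} eq (ex A) =
  cong ex (psub-idAtom (λ {_} {k} x → trans (cong (ren (wkArgs k)) (eq x)) (wkArgs-idAtom (π x))) A)

psub-sub0-pren-there : ∀ {s s' k Δ n} (Φ : Fm s' Δ (k + n)) (A : Fm s Δ n) →
                       psub (sub0 Φ) (pren there A) ≡ A
psub-sub0-pren-there Φ A =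
  trans (psub-pren (sub0 Φ) there A) (trans (psub-idAtom {π = id} (λ _ → refl) A) (pren-id (λ _ → refl) A))

◇-ren : ∀ {s Δ n m} (ρ : Fin n → Fin m) (A : Fm s Δ n) → ren ρ A ◇ ≡ ren ρ (A ◇)
◇-ren ρ ⊤ᶜ                = refl
◇-ren ρ ⊥ᶜ                = refl
◇-ren ρ ✓                 = refl
◇-ren ρ ⋏                 = refl
◇-ren {C} ρ (atom x ts)   = refl
◇-ren {I} ρ (atom x ts)   = refl
◇-ren ρ (¿ A)             = cong (BoxDia ∘ ¿_) (◇-ren ρ A)
◇-ren ρ (¡ A)             = cong ¡_ (◇-ren ρ A)
◇-ren {C} ρ (bin o A B)   = cong₂ (λ X Y → BoxDia (bin o X Y)) (◇-ren ρ A) (◇-ren ρ B)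
◇-ren {I} ρ (bin o A B)   = cong₂ (bin o) (◇-ren ρ A) (◇-ren ρ B)
◇-ren ρ (¬ᶜ A)            = cong (BoxDia ∘ ¬ᶜ_) (◇-ren ρ A)
◇-ren {C} ρ (all A)       = cong (BoxDia ∘ all) (◇-ren (liftR ρ) A)
◇-ren {I} ρ (all A)       = cong all (◇-ren (liftR ρ) A)
◇-ren {C} ρ (ex A)        = cong (BoxDia ∘ ex) (◇-ren (liftR ρ) A)
◇-ren {I} ρ (ex A)        = cong ex (◇-ren (liftR ρ) A)

◇-pren : ∀ {s Δ Δ' n} (π : PRen Δ Δ') (A : Fm s Δ n) → pren π A ◇ ≡ pren π (A ◇)
◇-pren π ⊤ᶜ               = refl
◇-pren π ⊥ᶜ               = refl
◇-pren π ✓                = refl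
◇-pren π ⋏                = refl
◇-pren {C} π (atom x ts)  = refl
◇-pren {I} π (atom x ts)  = refl
◇-pren π (¿ A)            = cong (BoxDia ∘ ¿_) (◇-pren π A)
◇-pren π (¡ A)            = cong ¡_ (◇-pren π A)
◇-pren {C} π (bin o A B)  = cong₂ (λ X Y → BoxDia (bin o X Y)) (◇-pren π A) (◇-pren π B)
◇-pren {I} π (bin o A B)  = cong₂ (bin o) (◇-pren π A) (◇-pren π B)
◇-pren π (¬ᶜ A)           = cong (BoxDia ∘ ¬ᶜ_) (◇-pren π A)
◇-pren {C} π (all A)      = cong (BoxDia ∘ all) (◇-pren π A)
◇-pren {I} π (all A)      = cong all (◇-pren π A)
◇-pren {C} π (ex A)       = cong (BoxDia ∘ ex) (◇-pren π A)
◇-pren {I} π (ex A)       = cong ex (◇-pren π A)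

renM-∘ : ∀ {Δ n m l} {ρ : Fin m → Fin l} {ρ' : Fin n → Fin m} {τ : Fin n → Fin l} →
         ρ ∘ ρ' ≗ τ → (M : MF Δ n) → renM ρ (renM ρ' M) ≡ renM τ M
renM-∘ eq (fm A)     = cong fm (ren-∘ eq A)
renM-∘ eq (M & N)    = cong₂ _&_ (renM-∘ eq M) (renM-∘ eq N)
renM-∘ eq (M ⇒ N)    = cong₂ _⇒_ (renM-∘ eq M) (renM-∘ eq N)
renM-∘ eq (Πi M)     = cong Πi (renM-∘ (liftR-∘ eq) M)
renM-∘ eq (Πp s k M) = cong (Πp s k) (renM-∘ eq M)

renM-id : ∀ {Δ n} {ρ : Fin n → Fin n} → ρ ≗ id → (M : MF Δ n) → renM ρ M ≡ M
renM-id eq (fm A)     = cong fm (ren-id eq A)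
renM-id eq (M & N)    = cong₂ _&_ (renM-id eq M) (renM-id eq N)
renM-id eq (M ⇒ N)    = cong₂ _⇒_ (renM-id eq M) (renM-id eq N)
renM-id eq (Πi M)     = cong Πi (renM-id (liftR-id eq) M)
renM-id eq (Πp s k M) = cong (Πp s k) (renM-id eq M)

renM-∘-id : ∀ {Δ n m} {ρ : Fin m → Fin n} {ρ' : Fin n → Fin m} →
            ρ ∘ ρ' ≗ id → (M : MF Δ n) → renM ρ (renM ρ' M) ≡ M
renM-∘-id eq M = trans (renM-∘ eq M) (renM-id (λ _ → refl) M)

liftPR-id : ∀ {Δ y} {π : PRen Δ Δ} → (∀ {x} (v : Δ ∋ x) → π v ≡ v) →
            ∀ {x} (v : (y ∷ Δ) ∋ x) → liftPR π v ≡ v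
liftPR-id eq here      = refl
liftPR-id eq (there v) = cong there (eq v)

prenM-id : ∀ {Δ n} {π : PRen Δ Δ} → (∀ {x} (v : Δ ∋ x) → π v ≡ v) → (M : MF Δ n) → prenM π M ≡ M
prenM-id eq (fm A)     = cong fm (pren-id eq A)
prenM-id eq (M & N)    = cong₂ _&_ (prenM-id eq M) (prenM-id eq N)
prenM-id eq (M ⇒ N)    = cong₂ _⇒_ (prenM-id eq M) (prenM-id eq N)
prenM-id eq (Πi M)     = cong Πi (prenM-id eq M)
prenM-id eq (Πp s k M) = cong (Πp s k) (prenM-id (liftPR-id eq) M)

psubM-cong : ∀ {Δ Δ' n} {σ σ' : PSub Δ Δ' n} → (∀ {s k} (x : Δ ∋ (s , k)) → σ x ≡ σ' x) →
             (M : MF Δ n) → psubM σ M ≡ psubM σ' M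
psubM-cong eq (fm A)     = cong fm (psub-cong eq A)
psubM-cong eq (M & N)    = cong₂ _&_ (psubM-cong eq M) (psubM-cong eq N)
psubM-cong eq (M ⇒ N)    = cong₂ _⇒_ (psubM-cong eq M) (psubM-cong eq N)
psubM-cong eq (Πi M)     = cong Πi (psubM-cong (λ {_} {k} x → cong (ren (wkArgs k)) (eq x)) M)
psubM-cong eq (Πp s k M) = cong (Πp s k) (psubM-cong lifted M)
  where
  lifted : ∀ {s' k'} (x : _ ∋ (s' , k')) → liftPSp _ x ≡ liftPSp _ x
  lifted here      = refl
  lifted (there x) = cong (pren there) (eq x)

psubM-prenM : ∀ {Δ Δ' Δ'' n} (σ : PSub Δ' Δ'' n) (π : PRen Δ Δ') (M : MF Δ n) →
              psubM σ (prenM π M) ≡ psubM (σ ∘ π) M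
psubM-prenM σ π (fm A)     = cong fm (psub-pren σ π A)
psubM-prenM σ π (M & N)    = cong₂ _&_ (psubM-prenM σ π M) (psubM-prenM σ π N)
psubM-prenM σ π (M ⇒ N)    = cong₂ _⇒_ (psubM-prenM σ π M) (psubM-prenM σ π N)
psubM-prenM σ π (Πi M)     = cong Πi (psubM-prenM (liftPS σ) π M)
psubM-prenM σ π (Πp s k M) =
  cong (Πp s k) (trans (psubM-prenM (liftPSp σ) (liftPR π) M) (psubM-cong lifted M))
  where
  lifted : ∀ {s' k'} (x : _ ∋ (s' , k')) → liftPSp σ (liftPR π x) ≡ liftPSp (σ ∘ π) x
  lifted here      = refl
  lifted (there x) = refl

psubM-idAtom : ∀ {Δ Δ' n} {σ : PSub Δ Δ' n} {π : PRen Δ Δ'} →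
               (∀ {s k} (x : Δ ∋ (s , k)) → σ x ≡ idAtom (π x)) → (M : MF Δ n) → psubM σ M ≡ prenM π M
psubM-idAtom eq (fm A)  = cong fm (psub-idAtom eq A)
psubM-idAtom eq (M & N) = cong₂ _&_ (psubM-idAtom eq M) (psubM-idAtom eq N)
psubM-idAtom eq (M ⇒ N) = cong₂ _⇒_ (psubM-idAtom eq M) (psubM-idAtom eq N)
psubM-idAtom {π = π} eq (Πi M) =
  cong Πi (psubM-idAtom (λ {_} {k} x → trans (cong (ren (wkArgs k)) (eq x)) (wkArgs-idAtom (π x))) M)
psubM-idAtom {σ = σ} {π} eq (Πp s k M) = cong (Πp s k) (psubM-idAtom lifted M)
  where
  lifted : ∀ {s' k'} (x : _ ∋ (s' , k')) → liftPSp σ x ≡ idAtom (liftPR π x)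
  lifted here      = refl
  lifted (there x) = cong (pren there) (eq x)

sub0i-zero-liftR-suc : ∀ {n} → sub0i {suc n} zero ∘ liftR suc ≗ id
sub0i-zero-liftR-suc zero    = refl
sub0i-zero-liftR-suc (suc i) = refl

◇M : ∀ {Δ n} → MF Δ n → MF Δ n
◇M (fm A)     = fm (A ◇)
◇M (M & N)    = ◇M M & ◇M N
◇M (M ⇒ N)    = ◇M M ⇒ ◇M N
◇M (Πi M)     = Πi (◇M M)
◇M (Πp s k M) = Πp s k (◇M M)

◇M-renM : ∀ {Δ n m} (ρ : Fin n → Fin m) (M : MF Δ n) → ◇M (renM ρ M) ≡ renM ρ (◇M M)
◇M-renM ρ (fm A)     = cong fm (◇-ren ρ A)
◇M-renM ρ (M & N)    = cong₂ _&_ (◇M-renM ρ M) (◇M-renM ρ N)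
◇M-renM ρ (M ⇒ N)    = cong₂ _⇒_ (◇M-renM ρ M) (◇M-renM ρ N)
◇M-renM ρ (Πi M)     = cong Πi (◇M-renM (liftR ρ) M)
◇M-renM ρ (Πp s k M) = cong (Πp s k) (◇M-renM ρ M)

◇M-prenM : ∀ {Δ Δ' n} (π : PRen Δ Δ') (M : MF Δ n) → ◇M (prenM π M) ≡ prenM π (◇M M)
◇M-prenM π (fm A)     = cong fm (◇-pren π A)
◇M-prenM π (M & N)    = cong₂ _&_ (◇M-prenM π M) (◇M-prenM π N)
◇M-prenM π (M ⇒ N)    = cong₂ _⇒_ (◇M-prenM π M) (◇M-prenM π N)
◇M-prenM π (Πi M)     = cong Πi (◇M-prenM π M)
◇M-prenM π (Πp s k M) = cong (Πp s k) (◇M-prenM (liftPR π) M)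

map-commute : ∀ {A B C D : Set} {f : B → D} {g : A → B} {f' : A → C} {g' : C → D} →
              f ∘ g ≗ g' ∘ f' → ∀ xs → map f (map g xs) ≡ map g' (map f' xs)
map-commute eq xs = trans (sym (Listₚ.map-∘ xs)) (trans (Listₚ.map-cong eq xs) (Listₚ.map-∘ xs))

Deriv-weaken : ∀ {Δ n} {Γ Γ' : List (MF Δ n)} {M} → Γ ⊆ Γ' → Deriv Γ M → Deriv Γ' M
Deriv-weaken Γ⊆Γ' (hyp x)   = hyp (Γ⊆Γ' x)
Deriv-weaken Γ⊆Γ' (&I d e)  = &I (Deriv-weaken Γ⊆Γ' d) (Deriv-weaken Γ⊆Γ' e)
Deriv-weaken Γ⊆Γ' (&E₁ d)   = &E₁ (Deriv-weaken Γ⊆Γ' d)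
Deriv-weaken Γ⊆Γ' (&E₂ d)   = &E₂ (Deriv-weaken Γ⊆Γ' d)
Deriv-weaken Γ⊆Γ' (⇒I d)    = ⇒I (Deriv-weaken (∷⁺ʳ _ Γ⊆Γ') d)
Deriv-weaken Γ⊆Γ' (⇒E d e)  = ⇒E (Deriv-weaken Γ⊆Γ' d) (Deriv-weaken Γ⊆Γ' e)
Deriv-weaken Γ⊆Γ' (ΠiI d)   = ΠiI (Deriv-weaken (map⁺ (renM suc) Γ⊆Γ') d)
Deriv-weaken Γ⊆Γ' (ΠiE d t) = ΠiE (Deriv-weaken Γ⊆Γ' d) t
Deriv-weaken Γ⊆Γ' (ΠpI d)   = ΠpI (Deriv-weaken (map⁺ (prenM there) Γ⊆Γ') d)
Deriv-weaken Γ⊆Γ' (ΠpE d Φ) = ΠpE (Deriv-weaken Γ⊆Γ' d) Φ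

Deriv-weaken₁ : ∀ {Δ n} {Γ : List (MF Δ n)} {M N} → Deriv Γ M → Deriv (N ∷ Γ) M
Deriv-weaken₁ = Deriv-weaken (xs⊆x∷xs _ _)

ΠiE-fresh : ∀ {Δ n} {Γ : List (MF Δ (suc n))} {M} → Deriv Γ (renM suc (Πi M)) → Deriv Γ M
ΠiE-fresh {M = M} d = subst (Deriv _) (renM-∘-id sub0i-zero-liftR-suc M) (ΠiE d zero)

⋀-intro : ∀ {Δ n} {Γ : List (MF Δ n)} {M Ms} → Deriv Γ M → All (Deriv Γ) Ms → Deriv Γ (⋀ M Ms)
⋀-intro d []       = d
⋀-intro d (e ∷ es) = &I d (⋀-intro e es)

nth : ∀ {Δ n} → ℕ → MF Δ n → List (MF Δ n) → MF Δ n
nth zero    M Ms       = M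
nth (suc k) M []       = M
nth (suc k) M (N ∷ Ns) = nth k N Ns

⋀-elim : ∀ {Δ n} {Γ : List (MF Δ n)} k {M Ms} → Deriv Γ (⋀ M Ms) → Deriv Γ (nth k M Ms)
⋀-elim zero    {Ms = []}    d = d
⋀-elim zero    {Ms = _ ∷ _} d = &E₁ d
⋀-elim (suc k) {Ms = []}    d = d
⋀-elim (suc k) {Ms = _ ∷ _} d = ⋀-elim k (&E₂ d)

-- 𝒟 is closed, so renM suc 𝒟 and prenM there 𝒟 compute to 𝒟.
Has𝒟 : ∀ {Δ n} → List (MF Δ n) → Set
Has𝒟 Γ = 𝒟 ∈ Γ

Has𝒟-renM : ∀ {Δ n} {Γ : List (MF Δ n)} → Has𝒟 Γ → Has𝒟 (map (renM suc) Γ)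
Has𝒟-renM = ∈-map⁺ (renM suc)

Has𝒟-prenM : ∀ {Δ n y} {Γ : List (MF Δ n)} → Has𝒟 Γ → Has𝒟 (map (prenM (there {y = y})) Γ)
Has𝒟-prenM = ∈-map⁺ (prenM there)

infix 4 _⊢_
_⊢_ : ∀ {s Δ n} → List (MF Δ n) → Fm s Δ n → Set
Γ ⊢ A = Deriv Γ (fm A)

-- The propositional axioms of 𝒟 quantify over 0-ary predicate variables. A schema is such an
-- axiom with holes for these variables, so that eliminating its Πp's is one substitution lemma.

data Schema (sv : Sort) (m : ℕ) : Sort → Set where
  var        : Fin m → Schema sv m sv
  ⊤ˢ ⊥ˢ      : Schema sv m C
  ✓ˢ ⋏ˢ      : Schema sv m I
  ¿ˢ_        : Schema sv m I → Schema sv m C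
  ¡ˢ_        : Schema sv m C → Schema sv m I
  binˢ       : ∀ {s} → BinOp → Schema sv m s → Schema sv m s → Schema sv m s
  ¬ˢ_        : Schema sv m C → Schema sv m C

infixr 30 ¿ˢ_ ¡ˢ_ ¬ˢ_

data MSchema (sv : Sort) (m : ℕ) : Set where
  fmˢ        : ∀ {s} → Schema sv m s → MSchema sv m
  _&ˢ_ _⇒ˢ_ : MSchema sv m → MSchema sv m → MSchema sv m

⟦_⟧ : ∀ {sv m s Δ n} → Schema sv m s → (Fin m → Fm sv Δ n) → Fm s Δ n
⟦ var i ⟧      ε = ε i
⟦ ⊤ˢ ⟧         ε = ⊤ᶜ
⟦ ⊥ˢ ⟧         ε = ⊥ᶜ
⟦ ✓ˢ ⟧         ε = ✓
⟦ ⋏ˢ ⟧         ε = ⋏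
⟦ ¿ˢ S ⟧       ε = ¿ ⟦ S ⟧ ε
⟦ ¡ˢ S ⟧       ε = ¡ ⟦ S ⟧ ε
⟦ binˢ o S T ⟧ ε = bin o (⟦ S ⟧ ε) (⟦ T ⟧ ε)
⟦ ¬ˢ S ⟧       ε = ¬ᶜ ⟦ S ⟧ ε

⟦_⟧ᴹ : ∀ {sv m Δ n} → MSchema sv m → (Fin m → Fm sv Δ n) → MF Δ n
⟦ fmˢ S ⟧ᴹ   ε = fm (⟦ S ⟧ ε)
⟦ M &ˢ N ⟧ᴹ ε = ⟦ M ⟧ᴹ ε & ⟦ N ⟧ᴹ ε
⟦ M ⇒ˢ N ⟧ᴹ ε = ⟦ M ⟧ᴹ ε ⇒ ⟦ N ⟧ᴹ ε

⟦⟧-cong : ∀ {sv m s Δ n} (S : Schema sv m s) {ε ε' : Fin m → Fm sv Δ n} → ε ≗ ε' → ⟦ S ⟧ ε ≡ ⟦ S ⟧ ε'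
⟦⟧-cong (var i)      eq = eq i
⟦⟧-cong ⊤ˢ           eq = refl
⟦⟧-cong ⊥ˢ           eq = refl
⟦⟧-cong ✓ˢ           eq = refl
⟦⟧-cong ⋏ˢ           eq = refl
⟦⟧-cong (¿ˢ S)       eq = cong ¿_ (⟦⟧-cong S eq)
⟦⟧-cong (¡ˢ S)       eq = cong ¡_ (⟦⟧-cong S eq)
⟦⟧-cong (binˢ o S T) eq = cong₂ (bin o) (⟦⟧-cong S eq) (⟦⟧-cong T eq)
⟦⟧-cong (¬ˢ S)       eq = cong ¬ᶜ_ (⟦⟧-cong S eq)

⟦⟧ᴹ-cong : ∀ {sv m Δ n} (M : MSchema sv m) {ε ε' : Fin m → Fm sv Δ n} → ε ≗ ε' → ⟦ M ⟧ᴹ ε ≡ ⟦ M ⟧ᴹ ε'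
⟦⟧ᴹ-cong (fmˢ S)   eq = cong fm (⟦⟧-cong S eq)
⟦⟧ᴹ-cong (M &ˢ N) eq = cong₂ _&_ (⟦⟧ᴹ-cong M eq) (⟦⟧ᴹ-cong N eq)
⟦⟧ᴹ-cong (M ⇒ˢ N) eq = cong₂ _⇒_ (⟦⟧ᴹ-cong M eq) (⟦⟧ᴹ-cong N eq)

psub-⟦⟧ : ∀ {sv m s Δ Δ' n} (σ : PSub Δ Δ' n) (S : Schema sv m s) (ε : Fin m → Fm sv Δ n) →
          psub σ (⟦ S ⟧ ε) ≡ ⟦ S ⟧ (psub σ ∘ ε)
psub-⟦⟧ σ (var i)      ε = refl
psub-⟦⟧ σ ⊤ˢ           ε = refl
psub-⟦⟧ σ ⊥ˢ           ε = refl
psub-⟦⟧ σ ✓ˢ           ε = refl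
psub-⟦⟧ σ ⋏ˢ           ε = refl
psub-⟦⟧ σ (¿ˢ S)       ε = cong ¿_ (psub-⟦⟧ σ S ε)
psub-⟦⟧ σ (¡ˢ S)       ε = cong ¡_ (psub-⟦⟧ σ S ε)
psub-⟦⟧ σ (binˢ o S T) ε = cong₂ (bin o) (psub-⟦⟧ σ S ε) (psub-⟦⟧ σ T ε)
psub-⟦⟧ σ (¬ˢ S)       ε = cong ¬ᶜ_ (psub-⟦⟧ σ S ε)

psubM-⟦⟧ᴹ : ∀ {sv m Δ Δ' n} (σ : PSub Δ Δ' n) (M : MSchema sv m) (ε : Fin m → Fm sv Δ n) →
            psubM σ (⟦ M ⟧ᴹ ε) ≡ ⟦ M ⟧ᴹ (psub σ ∘ ε)
psubM-⟦⟧ᴹ σ (fmˢ S)   ε = cong fm (psub-⟦⟧ σ S ε)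
psubM-⟦⟧ᴹ σ (M &ˢ N) ε = cong₂ _&_ (psubM-⟦⟧ᴹ σ M ε) (psubM-⟦⟧ᴹ σ N ε)
psubM-⟦⟧ᴹ σ (M ⇒ˢ N) ε = cong₂ _⇒_ (psubM-⟦⟧ᴹ σ M ε) (psubM-⟦⟧ᴹ σ N ε)

module _ {Δ n} {Γ : List (MF Δ n)} {sv : Sort} where

  instantiate₁ : (M : MSchema sv 1) → Deriv Γ (Πp sv 0 (⟦ M ⟧ᴹ (lookup (#0 ∷ [])))) →
                 (A : Fm sv Δ n) → Deriv Γ (⟦ M ⟧ᴹ (lookup (A ∷ [])))
  instantiate₁ M d A = subst (Deriv Γ) (trans (psubM-⟦⟧ᴹ (sub0 A) M _) (⟦⟧ᴹ-cong M instance₀)) (ΠpE d A)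
    where
    instance₀ : psub (sub0 A) ∘ lookup (#0 ∷ []) ≗ lookup (A ∷ [])
    instance₀ zero = ren-inst[] A

  instantiate₂ : (M : MSchema sv 2) → Deriv Γ (Πp sv 0 (Πp sv 0 (⟦ M ⟧ᴹ (lookup (#1 ∷ #0 ∷ []))))) →
                 (A B : Fm sv Δ n) → Deriv Γ (⟦ M ⟧ᴹ (lookup (A ∷ B ∷ [])))
  instantiate₂ M d A B = subst (Deriv Γ) eq (ΠpE (ΠpE d A) B)
    where
    instance₀ : psub (sub0 B) ∘ psub (liftPSp (sub0 A)) ∘ lookup (#1 ∷ #0 ∷ []) ≗ lookup (A ∷ B ∷ [])
    instance₀ zero       = trans (cong (psub (sub0 B)) (ren-inst[] (pren there A))) (psub-sub0-pren-there B A)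
    instance₀ (suc zero) = ren-inst[] B
    eq = trans (cong (psubM (sub0 B)) (psubM-⟦⟧ᴹ (liftPSp (sub0 A)) M _))
        (trans (psubM-⟦⟧ᴹ (sub0 B) M _) (⟦⟧ᴹ-cong M instance₀))

  instantiate₃ : (M : MSchema sv 3) →
                 Deriv Γ (Πp sv 0 (Πp sv 0 (Πp sv 0 (⟦ M ⟧ᴹ (lookup (#2 ∷ #1 ∷ #0 ∷ [])))))) →
                 (A B C' : Fm sv Δ n) → Deriv Γ (⟦ M ⟧ᴹ (lookup (A ∷ B ∷ C' ∷ [])))
  instantiate₃ M d A B C' = subst (Deriv Γ) eq (ΠpE (ΠpE (ΠpE d A) B) C')
    where
    σ₂ : PSub ((sv , 0) ∷ (sv , 0) ∷ (sv , 0) ∷ Δ) ((sv , 0) ∷ (sv , 0) ∷ Δ) n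
    σ₂ = liftPSp (liftPSp (sub0 A))
    σ₁ : PSub ((sv , 0) ∷ (sv , 0) ∷ Δ) ((sv , 0) ∷ Δ) n
    σ₁ = liftPSp (sub0 B)
    skip₁ : psub σ₁ (pren there (pren there A)) ≡ pren there A
    skip₁ = trans (psub-pren σ₁ there (pren there A))
                  (trans (psub-pren (λ x → σ₁ (there x)) there A) (psub-idAtom (λ _ → refl) A))
    instance₀ : psub (sub0 C') ∘ psub σ₁ ∘ psub σ₂ ∘ lookup (#2 ∷ #1 ∷ #0 ∷ []) ≗
                lookup (A ∷ B ∷ C' ∷ [])
    instance₀ zero             =
      trans (cong (psub (sub0 C')) (trans (cong (psub σ₁) (ren-inst[] (pren there (pren there A))))
                                  skip₁))
            (psub-sub0-pren-there C' A)
    instance₀ (suc zero)       =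
      trans (cong (psub (sub0 C')) (ren-inst[] (pren there B))) (psub-sub0-pren-there C' B)
    instance₀ (suc (suc zero)) = ren-inst[] C'
    eq = trans (cong (psubM (sub0 C') ∘ psubM σ₁) (psubM-⟦⟧ᴹ σ₂ M _))
        (trans (cong (psubM (sub0 C')) (psubM-⟦⟧ᴹ σ₁ M _))
        (trans (psubM-⟦⟧ᴹ (sub0 C') M _) (⟦⟧ᴹ-cong M instance₀)))

axioms𝒟 : ∀ {Δ n} → List (MF Δ n)
axioms𝒟 = intAxioms I ++ intAxioms C ++ classAxioms ++ qhcAxioms

module Axioms {Δ n} {Γ : List (MF Δ n)} (has𝒟 : Has𝒟 Γ) where

  -- 𝒟 lists ⊤ᶜ, then intAxioms I from index 1, intAxioms C from 19, classAxioms from 37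
  -- and qhcAxioms from 40.
  ax : ∀ k → Deriv Γ (nth k (fm ⊤ᶜ) axioms𝒟)
  ax k = ⋀-elim k (hyp has𝒟)

  private
    v₀ : ∀ {sv m} → Schema sv (suc m) sv
    v₀ = var zero
    v₁ : ∀ {sv m} → Schema sv (suc (suc m)) sv
    v₁ = var (suc zero)
    v₂ : ∀ {sv m} → Schema sv (suc (suc (suc m))) sv
    v₂ = var (suc (suc zero))
    _⊃ˢ_ _∧ˢ_ _∨ˢ_ _⇔ˢ_ : ∀ {sv m s} → Schema sv m s → Schema sv m s → Schema sv m s
    _⊃ˢ_ = binˢ impl
    _∧ˢ_ = binˢ conj
    _∨ˢ_ = binˢ disj
    _⇔ˢ_ = binˢ equiv
    infixr 20 _⊃ˢ_ _⇔ˢ_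
    infixr 25 _∧ˢ_ _∨ˢ_

  ax-K : ∀ {s} (A B : Fm s Δ n) → Γ ⊢ A ⊃ (B ⊃ A)
  ax-K {I} = instantiate₂ (fmˢ (v₀ ⊃ˢ v₁ ⊃ˢ v₀)) (ax 1)
  ax-K {C} = instantiate₂ (fmˢ (v₀ ⊃ˢ v₁ ⊃ˢ v₀)) (ax 19)

  ax-S : ∀ {s} (A B C' : Fm s Δ n) → Γ ⊢ (A ⊃ (B ⊃ C')) ⊃ ((A ⊃ B) ⊃ (A ⊃ C'))
  ax-S {I} = instantiate₃ (fmˢ ((v₀ ⊃ˢ v₁ ⊃ˢ v₂) ⊃ˢ (v₀ ⊃ˢ v₁) ⊃ˢ (v₀ ⊃ˢ v₂))) (ax 2)
  ax-S {C} = instantiate₃ (fmˢ ((v₀ ⊃ˢ v₁ ⊃ˢ v₂) ⊃ˢ (v₀ ⊃ˢ v₁) ⊃ˢ (v₀ ⊃ˢ v₂))) (ax 20)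

  ax-∧ˡ : ∀ {s} (A B : Fm s Δ n) → Γ ⊢ (A ∧' B) ⊃ A
  ax-∧ˡ {I} = instantiate₂ (fmˢ ((v₀ ∧ˢ v₁) ⊃ˢ v₀)) (ax 3)
  ax-∧ˡ {C} = instantiate₂ (fmˢ ((v₀ ∧ˢ v₁) ⊃ˢ v₀)) (ax 21)

  ax-∧ʳ : ∀ {s} (A B : Fm s Δ n) → Γ ⊢ (A ∧' B) ⊃ B
  ax-∧ʳ {I} = instantiate₂ (fmˢ ((v₀ ∧ˢ v₁) ⊃ˢ v₁)) (ax 4)
  ax-∧ʳ {C} = instantiate₂ (fmˢ ((v₀ ∧ˢ v₁) ⊃ˢ v₁)) (ax 22)

  ax-∧I : ∀ {s} (A B : Fm s Δ n) → Γ ⊢ A ⊃ (B ⊃ (A ∧' B))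
  ax-∧I {I} = instantiate₂ (fmˢ (v₀ ⊃ˢ v₁ ⊃ˢ (v₀ ∧ˢ v₁))) (ax 5)
  ax-∧I {C} = instantiate₂ (fmˢ (v₀ ⊃ˢ v₁ ⊃ˢ (v₀ ∧ˢ v₁))) (ax 23)

  ax-∨ˡ : ∀ {s} (A B : Fm s Δ n) → Γ ⊢ A ⊃ (A ∨' B)
  ax-∨ˡ {I} = instantiate₂ (fmˢ (v₀ ⊃ˢ (v₀ ∨ˢ v₁))) (ax 6)
  ax-∨ˡ {C} = instantiate₂ (fmˢ (v₀ ⊃ˢ (v₀ ∨ˢ v₁))) (ax 24)

  ax-∨ʳ : ∀ {s} (A B : Fm s Δ n) → Γ ⊢ B ⊃ (A ∨' B)
  ax-∨ʳ {I} = instantiate₂ (fmˢ (v₁ ⊃ˢ (v₀ ∨ˢ v₁))) (ax 7)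
  ax-∨ʳ {C} = instantiate₂ (fmˢ (v₁ ⊃ˢ (v₀ ∨ˢ v₁))) (ax 25)

  ax-∨E : ∀ {s} (A B C' : Fm s Δ n) → Γ ⊢ (A ⊃ C') ⊃ ((B ⊃ C') ⊃ ((A ∨' B) ⊃ C'))
  ax-∨E {I} = instantiate₃ (fmˢ ((v₀ ⊃ˢ v₂) ⊃ˢ (v₁ ⊃ˢ v₂) ⊃ˢ ((v₀ ∨ˢ v₁) ⊃ˢ v₂))) (ax 8)
  ax-∨E {C} = instantiate₃ (fmˢ ((v₀ ⊃ˢ v₂) ⊃ˢ (v₁ ⊃ˢ v₂) ⊃ˢ ((v₀ ∨ˢ v₁) ⊃ˢ v₂))) (ax 26)

  ax-⊥ : ∀ {s} (A : Fm s Δ n) → Γ ⊢ ⊥ₛ s ⊃ A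
  ax-⊥ {I} = instantiate₁ (fmˢ (⋏ˢ ⊃ˢ v₀)) (ax 9)
  ax-⊥ {C} = instantiate₁ (fmˢ (⊥ˢ ⊃ˢ v₀)) (ax 27)

  ax-⊤ : ∀ {s} → Γ ⊢ ⊤ₛ s {Δ} {n}
  ax-⊤ {I} = ax 10
  ax-⊤ {C} = ax 28

  ax-⇔⊃ : ∀ {s} (A B : Fm s Δ n) → Γ ⊢ (A ⇔' B) ⊃ (A ⊃ B)
  ax-⇔⊃ {I} = instantiate₂ (fmˢ ((v₀ ⇔ˢ v₁) ⊃ˢ (v₀ ⊃ˢ v₁))) (ax 11)
  ax-⇔⊃ {C} = instantiate₂ (fmˢ ((v₀ ⇔ˢ v₁) ⊃ˢ (v₀ ⊃ˢ v₁))) (ax 29)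

  ax-⇔⊂ : ∀ {s} (A B : Fm s Δ n) → Γ ⊢ (A ⇔' B) ⊃ (B ⊃ A)
  ax-⇔⊂ {I} = instantiate₂ (fmˢ ((v₀ ⇔ˢ v₁) ⊃ˢ (v₁ ⊃ˢ v₀))) (ax 12)
  ax-⇔⊂ {C} = instantiate₂ (fmˢ ((v₀ ⇔ˢ v₁) ⊃ˢ (v₁ ⊃ˢ v₀))) (ax 30)

  ax-⇔I : ∀ {s} (A B : Fm s Δ n) → Γ ⊢ (A ⊃ B) ⊃ ((B ⊃ A) ⊃ (A ⇔' B))
  ax-⇔I {I} = instantiate₂ (fmˢ ((v₀ ⊃ˢ v₁) ⊃ˢ (v₁ ⊃ˢ v₀) ⊃ˢ (v₀ ⇔ˢ v₁))) (ax 13)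
  ax-⇔I {C} = instantiate₂ (fmˢ ((v₀ ⊃ˢ v₁) ⊃ˢ (v₁ ⊃ˢ v₀) ⊃ˢ (v₀ ⇔ˢ v₁))) (ax 31)

  rule-mp : ∀ {s} (A B : Fm s Δ n) → Deriv Γ ((fm A & fm (A ⊃ B)) ⇒ fm B)
  rule-mp {I} = instantiate₂ ((fmˢ v₀ &ˢ fmˢ (v₀ ⊃ˢ v₁)) ⇒ˢ fmˢ v₁) (ax 14)
  rule-mp {C} = instantiate₂ ((fmˢ v₀ &ˢ fmˢ (v₀ ⊃ˢ v₁)) ⇒ˢ fmˢ v₁) (ax 32)

  mp : ∀ {s} {A B : Fm s Δ n} → Γ ⊢ A ⊃ B → Γ ⊢ A → Γ ⊢ B
  mp {A = A} {B} f a = ⇒E (rule-mp A B) (&I a f)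

  ax-¬¬ : (A : Fm C Δ n) → Γ ⊢ ¬ᶜ ¬ᶜ A ⊃ A
  ax-¬¬ = instantiate₁ (fmˢ (¬ˢ ¬ˢ v₀ ⊃ˢ v₀)) (ax 37)

  ax-¬E : (A : Fm C Δ n) → Γ ⊢ ¬ᶜ A ⊃ (A ⊃ ⊥ᶜ)
  ax-¬E = instantiate₁ (fmˢ (¬ˢ v₀ ⊃ˢ (v₀ ⊃ˢ ⊥ˢ))) (ax 38)

  ax-¬I : (A : Fm C Δ n) → Γ ⊢ (A ⊃ ⊥ᶜ) ⊃ ¬ᶜ A
  ax-¬I = instantiate₁ (fmˢ ((v₀ ⊃ˢ ⊥ˢ) ⊃ˢ ¬ˢ v₀)) (ax 39)

  ax-¿∧ : (A B : Fm I Δ n) → Γ ⊢ ¿ (A ∧' B) ⇔' (¿ A ∧' ¿ B)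
  ax-¿∧ = instantiate₂ (fmˢ (¿ˢ (v₀ ∧ˢ v₁) ⇔ˢ (¿ˢ v₀ ∧ˢ ¿ˢ v₁))) (ax 40)

  ax-¿∨ : (A B : Fm I Δ n) → Γ ⊢ ¿ (A ∨' B) ⇔' (¿ A ∨' ¿ B)
  ax-¿∨ = instantiate₂ (fmˢ (¿ˢ (v₀ ∨ˢ v₁) ⇔ˢ (¿ˢ v₀ ∨ˢ ¿ˢ v₁))) (ax 41)

  ax-¿⊃ : (A B : Fm I Δ n) → Γ ⊢ ¿ (A ⊃ B) ⊃ (¿ A ⊃ ¿ B)
  ax-¿⊃ = instantiate₂ (fmˢ (¿ˢ (v₀ ⊃ˢ v₁) ⊃ˢ (¿ˢ v₀ ⊃ˢ ¿ˢ v₁))) (ax 42)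

  ax-¬¿⋏ : Γ ⊢ ¬ᶜ ¿ (⋏ {Δ} {n})
  ax-¬¿⋏ = ax 43

  ax-¡¿ : (A : Fm I Δ n) → Γ ⊢ A ⊃ ¡ ¿ A
  ax-¡¿ = instantiate₁ (fmˢ (v₀ ⊃ˢ ¡ˢ ¿ˢ v₀)) (ax 46)

  ax-¬¡⊥ : Γ ⊢ ¬ⁱ ¡ (⊥ᶜ {Δ} {n})
  ax-¬¡⊥ = ax 47

  ax-¿¡ : (A : Fm C Δ n) → Γ ⊢ ¿ ¡ A ⊃ A
  ax-¿¡ = instantiate₁ (fmˢ (¿ˢ ¡ˢ v₀ ⊃ˢ v₀)) (ax 48)

  ax-¡¿¡ : (A : Fm C Δ n) → Γ ⊢ ¡ A ⊃ ¡ ¿ ¡ A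
  ax-¡¿¡ = instantiate₁ (fmˢ (¡ˢ v₀ ⊃ˢ ¡ˢ ¿ˢ ¡ˢ v₀)) (ax 49)

  ax-¡⊃ : (A B : Fm C Δ n) → Γ ⊢ ¡ (A ⊃ B) ⊃ (¡ A ⊃ ¡ B)
  ax-¡⊃ = instantiate₂ (fmˢ (¡ˢ (v₀ ⊃ˢ v₁) ⊃ˢ (¡ˢ v₀ ⊃ˢ ¡ˢ v₁))) (ax 50)

  rule-¡E : (A : Fm C Δ n) → Deriv Γ (fm (¡ A) ⇒ fm A)
  rule-¡E = instantiate₁ (fmˢ (¡ˢ v₀) ⇒ˢ fmˢ v₀) (ax 51)

  rule-¡I : (A : Fm C Δ n) → Deriv Γ (fm A ⇒ fm (¡ A))
  rule-¡I = instantiate₁ (fmˢ v₀ ⇒ˢ fmˢ (¡ˢ v₀)) (ax 52)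

-- Derived rules. A hypothesis formula H plays the role of a context; (H ∧' A) extends it by A.

module Propositional {Δ n} {Γ : List (MF Δ n)} (has𝒟 : Has𝒟 Γ) where
  open Axioms has𝒟 public

  module _ {s : Sort} where

    ⊃-refl : (A : Fm s Δ n) → Γ ⊢ A ⊃ A
    ⊃-refl A = mp (mp (ax-S A (A ⊃ A) A) (ax-K A (A ⊃ A))) (ax-K A A)

    ⊃-const : {A B : Fm s Δ n} → Γ ⊢ B → Γ ⊢ A ⊃ B
    ⊃-const {A} {B} d = mp (ax-K B A) d

    ⊃-ap : {H A B : Fm s Δ n} → Γ ⊢ H ⊃ (A ⊃ B) → Γ ⊢ H ⊃ A → Γ ⊢ H ⊃ B
    ⊃-ap {H} {A} {B} f a = mp (mp (ax-S H A B) f) a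

    ⊃-trans : {A B C' : Fm s Δ n} → Γ ⊢ A ⊃ B → Γ ⊢ B ⊃ C' → Γ ⊢ A ⊃ C'
    ⊃-trans f g = ⊃-ap (⊃-const g) f

    ∧-intro : {H A B : Fm s Δ n} → Γ ⊢ H ⊃ A → Γ ⊢ H ⊃ B → Γ ⊢ H ⊃ (A ∧' B)
    ∧-intro {A = A} {B} a b = ⊃-ap (⊃-ap (⊃-const (ax-∧I A B)) a) b

    ∧-elimˡ : {H A B : Fm s Δ n} → Γ ⊢ H ⊃ (A ∧' B) → Γ ⊢ H ⊃ A
    ∧-elimˡ {A = A} {B} d = ⊃-trans d (ax-∧ˡ A B)

    ∧-elimʳ : {H A B : Fm s Δ n} → Γ ⊢ H ⊃ (A ∧' B) → Γ ⊢ H ⊃ B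
    ∧-elimʳ {A = A} {B} d = ⊃-trans d (ax-∧ʳ A B)

    ∧-comm : {A B : Fm s Δ n} → Γ ⊢ (A ∧' B) ⊃ (B ∧' A)
    ∧-comm = ∧-intro (ax-∧ʳ _ _) (ax-∧ˡ _ _)

    var₀ : {H A : Fm s Δ n} → Γ ⊢ (H ∧' A) ⊃ A
    var₀ {H} {A} = ax-∧ʳ H A

    weaken₀ : {H A X : Fm s Δ n} → Γ ⊢ H ⊃ X → Γ ⊢ (H ∧' A) ⊃ X
    weaken₀ {H} {A} f = ⊃-trans (ax-∧ˡ H A) f

    ⊃-curry : {H A B : Fm s Δ n} → Γ ⊢ (H ∧' A) ⊃ B → Γ ⊢ H ⊃ (A ⊃ B)
    ⊃-curry {H} {A} {B} f = ⊃-ap (⊃-ap (⊃-const (ax-S A (H ∧' A) B)) (⊃-const (⊃-const f))) (ax-∧I H A)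

    ⊃-uncurry : {H A B : Fm s Δ n} → Γ ⊢ H ⊃ (A ⊃ B) → Γ ⊢ (H ∧' A) ⊃ B
    ⊃-uncurry f = ⊃-ap (weaken₀ f) var₀

    ∨-introˡ : {H A B : Fm s Δ n} → Γ ⊢ H ⊃ A → Γ ⊢ H ⊃ (A ∨' B)
    ∨-introˡ {A = A} {B} d = ⊃-trans d (ax-∨ˡ A B)

    ∨-introʳ : {H A B : Fm s Δ n} → Γ ⊢ H ⊃ B → Γ ⊢ H ⊃ (A ∨' B)
    ∨-introʳ {A = A} {B} d = ⊃-trans d (ax-∨ʳ A B)

    ∨-elim : {H A B C' : Fm s Δ n} → Γ ⊢ H ⊃ (A ∨' B) →
             Γ ⊢ (H ∧' A) ⊃ C' → Γ ⊢ (H ∧' B) ⊃ C' → Γ ⊢ H ⊃ C'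
    ∨-elim {A = A} {B} {C'} d f g = ⊃-ap (⊃-ap (⊃-ap (⊃-const (ax-∨E A B C')) (⊃-curry f)) (⊃-curry g)) d

    ⇔-intro : {H A B : Fm s Δ n} → Γ ⊢ H ⊃ (A ⊃ B) → Γ ⊢ H ⊃ (B ⊃ A) → Γ ⊢ H ⊃ (A ⇔' B)
    ⇔-intro {A = A} {B} f g = ⊃-ap (⊃-ap (⊃-const (ax-⇔I A B)) f) g

    ⇔-elimˡ : {H A B : Fm s Δ n} → Γ ⊢ H ⊃ (A ⇔' B) → Γ ⊢ H ⊃ (A ⊃ B)
    ⇔-elimˡ {A = A} {B} d = ⊃-trans d (ax-⇔⊃ A B)

    ⇔-elimʳ : {H A B : Fm s Δ n} → Γ ⊢ H ⊃ (A ⇔' B) → Γ ⊢ H ⊃ (B ⊃ A)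
    ⇔-elimʳ {A = A} {B} d = ⊃-trans d (ax-⇔⊂ A B)

    mk⇔ : {A B : Fm s Δ n} → Γ ⊢ A ⊃ B → Γ ⊢ B ⊃ A → Γ ⊢ A ⇔' B
    mk⇔ {A} {B} f g = mp (mp (ax-⇔I A B) f) g

    ⇔-to : {A B : Fm s Δ n} → Γ ⊢ A ⇔' B → Γ ⊢ A ⊃ B
    ⇔-to {A} {B} d = mp (ax-⇔⊃ A B) d

    ⇔-from : {A B : Fm s Δ n} → Γ ⊢ A ⇔' B → Γ ⊢ B ⊃ A
    ⇔-from {A} {B} d = mp (ax-⇔⊂ A B) d

    ⊥ₛ-elim : {H A : Fm s Δ n} → Γ ⊢ H ⊃ ⊥ₛ s → Γ ⊢ H ⊃ A
    ⊥ₛ-elim {A = A} d = ⊃-trans d (ax-⊥ A)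

    ⇔-refl : (A : Fm s Δ n) → Γ ⊢ A ⇔' A
    ⇔-refl A = mk⇔ (⊃-refl A) (⊃-refl A)

    ⇔-sym : {A B : Fm s Δ n} → Γ ⊢ A ⇔' B → Γ ⊢ B ⇔' A
    ⇔-sym d = mk⇔ (⇔-from d) (⇔-to d)

    ⇔-trans : {A B C' : Fm s Δ n} → Γ ⊢ A ⇔' B → Γ ⊢ B ⇔' C' → Γ ⊢ A ⇔' C'
    ⇔-trans d e = mk⇔ (⊃-trans (⇔-to d) (⇔-to e)) (⊃-trans (⇔-from e) (⇔-from d))

    ∧-mono : {A A' B B' : Fm s Δ n} → Γ ⊢ A ⊃ A' → Γ ⊢ B ⊃ B' → Γ ⊢ (A ∧' B) ⊃ (A' ∧' B')
    ∧-mono f g = ∧-intro (⊃-trans (ax-∧ˡ _ _) f) (⊃-trans (ax-∧ʳ _ _) g)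

    ∨-mono : {A A' B B' : Fm s Δ n} → Γ ⊢ A ⊃ A' → Γ ⊢ B ⊃ B' → Γ ⊢ (A ∨' B) ⊃ (A' ∨' B')
    ∨-mono f g = ∨-elim (⊃-refl _) (∨-introˡ (⊃-trans var₀ f)) (∨-introʳ (⊃-trans var₀ g))

    ⊃-mono : {A A' B B' : Fm s Δ n} → Γ ⊢ A' ⊃ A → Γ ⊢ B ⊃ B' → Γ ⊢ (A ⊃ B) ⊃ (A' ⊃ B')
    ⊃-mono f g = ⊃-curry (⊃-trans (⊃-ap (ax-∧ˡ _ _) (⊃-trans var₀ f)) g)

    ⇔-mono : {A A' B B' : Fm s Δ n} → Γ ⊢ A ⇔' A' → Γ ⊢ B ⇔' B' → Γ ⊢ (A ⇔' B) ⊃ (A' ⇔' B')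
    ⇔-mono d e = ⇔-intro (⊃-trans (⇔-elimˡ (⊃-refl _)) (⊃-mono (⇔-from d) (⇔-to e)))
                         (⊃-trans (⇔-elimʳ (⊃-refl _)) (⊃-mono (⇔-from e) (⇔-to d)))

    bin-cong : (o : BinOp) {A A' B B' : Fm s Δ n} → Γ ⊢ A ⇔' A' → Γ ⊢ B ⇔' B' → Γ ⊢ bin o A B ⇔' bin o A' B'
    bin-cong conj  d e = mk⇔ (∧-mono (⇔-to d) (⇔-to e)) (∧-mono (⇔-from d) (⇔-from e))
    bin-cong disj  d e = mk⇔ (∨-mono (⇔-to d) (⇔-to e)) (∨-mono (⇔-from d) (⇔-from e))
    bin-cong impl  d e = mk⇔ (⊃-mono (⇔-from d) (⇔-to e)) (⊃-mono (⇔-to d) (⇔-from e))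
    bin-cong equiv d e = mk⇔ (⇔-mono d e) (⇔-mono (⇔-sym d) (⇔-sym e))

  ¬ᶜ-elim : {H A : Fm C Δ n} → Γ ⊢ H ⊃ ¬ᶜ A → Γ ⊢ H ⊃ A → Γ ⊢ H ⊃ ⊥ᶜ
  ¬ᶜ-elim {A = A} f a = ⊃-ap (⊃-trans f (ax-¬E A)) a

  ¬ᶜ-intro : {H A : Fm C Δ n} → Γ ⊢ (H ∧' A) ⊃ ⊥ᶜ → Γ ⊢ H ⊃ ¬ᶜ A
  ¬ᶜ-intro {A = A} f = ⊃-trans (⊃-curry f) (ax-¬I A)

  contraposition : {A B : Fm C Δ n} → Γ ⊢ A ⊃ B → Γ ⊢ ¬ᶜ B ⊃ ¬ᶜ A
  contraposition f = ¬ᶜ-intro (¬ᶜ-elim (weaken₀ (⊃-refl _)) (⊃-trans var₀ f))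

  ¬ᶜ-cong : {A A' : Fm C Δ n} → Γ ⊢ A ⇔' A' → Γ ⊢ ¬ᶜ A ⇔' ¬ᶜ A'
  ¬ᶜ-cong d = mk⇔ (contraposition (⇔-from d)) (contraposition (⇔-to d))

  ¬¬ᶜ-intro : (A : Fm C Δ n) → Γ ⊢ A ⊃ ¬ᶜ ¬ᶜ A
  ¬¬ᶜ-intro A = ¬ᶜ-intro (¬ᶜ-elim var₀ (weaken₀ (⊃-refl _)))

  ¬¬ᶜ-⇔ : (A : Fm C Δ n) → Γ ⊢ ¬ᶜ ¬ᶜ A ⇔' A
  ¬¬ᶜ-⇔ A = mk⇔ (ax-¬¬ A) (¬¬ᶜ-intro A)

  ¬ᶜ⊥ᶜ : Γ ⊢ ¬ᶜ (⊥ᶜ {Δ} {n})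
  ¬ᶜ⊥ᶜ = mp (ax-¬I ⊥ᶜ) (⊃-refl ⊥ᶜ)

module QuantifierRules {Δ n} {Γ : List (MF Δ n)} (has𝒟 : Has𝒟 Γ) where
  open Propositional has𝒟

  private
    ax-∀E : ∀ s → Deriv Γ (Πp s 1 (Πi (fm (all (θ zero) ⊃ θ zero))))
    ax-∀E I = ax 15
    ax-∀E C = ax 33

    ax-∃I : ∀ s → Deriv Γ (Πp s 1 (Πi (fm (θ zero ⊃ ex (θ zero)))))
    ax-∃I I = ax 16
    ax-∃I C = ax 34

    rule-∀I : ∀ s → Deriv Γ (Πp s 0 (Πp s 1 (Πi (fm (atom (there here) [] ⊃ θ zero))
                                         ⇒ fm (atom (there here) [] ⊃ all (θ zero)))))
    rule-∀I I = ax 17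
    rule-∀I C = ax 35

    rule-∃E : ∀ s → Deriv Γ (Πp s 0 (Πp s 1 (Πi (fm (θ zero ⊃ atom (there here) []))
                                         ⇒ fm (ex (θ zero) ⊃ atom (there here) []))))
    rule-∃E I = ax 18
    rule-∃E C = ax 36

    inst-wkArgs : inst (zero ∷ []) ∘ wkArgs 1 {n} ≗ id
    inst-wkArgs zero    = refl
    inst-wkArgs (suc i) = refl

    sub0i-inst-wkArgs : (t : Fin n) → sub0i t ∘ inst (zero ∷ []) ∘ wkArgs 1 {n} ≗ sub0i t
    sub0i-inst-wkArgs t zero    = refl
    sub0i-inst-wkArgs t (suc i) = refl

    liftR-sub0i-inst-wkArgs² : (t : Fin n) →
      liftR (sub0i t) ∘ inst (zero ∷ []) ∘ wkArgs 1 {suc n} ∘ wkArgs 1 {n} ≗ id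
    liftR-sub0i-inst-wkArgs² t zero    = refl
    liftR-sub0i-inst-wkArgs² t (suc i) = refl

    θ-instance : ∀ {s} (Φ : Fm s Δ (suc n)) → ren (inst (zero ∷ [])) (ren (wkArgs 1) Φ) ≡ Φ
    θ-instance = ren-∘-id inst-wkArgs

    θ-instance-under-Πi : ∀ {s} (Φ : Fm s Δ (suc n)) (t : Fin n) →
      ren (liftR (sub0i t)) (ren (inst (zero ∷ [])) (ren (wkArgs 1) (ren (wkArgs 1) Φ))) ≡ Φ
    θ-instance-under-Πi Φ t =
      trans (cong (ren (liftR (sub0i t))) (ren-∘₃ (λ _ → refl) Φ))
            (ren-∘-id (liftR-sub0i-inst-wkArgs² t) Φ)

    p-instance : ∀ {s s'} (Φ : Fm s' Δ (1 + n)) (P : Fm s Δ n) → psub (sub0 Φ) (ren (inst []) (pren there P)) ≡ P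
    p-instance Φ P = trans (cong (psub (sub0 Φ)) (ren-inst[] (pren there P))) (psub-sub0-pren-there Φ P)

    p-instance-under-Πi : ∀ {s s'} (Φ : Fm s' Δ (1 + n)) (P : Fm s Δ n) →
      psub (liftPS (sub0 Φ)) (ren (inst []) (ren (wkArgs 0) (pren there P))) ≡ ren suc P
    p-instance-under-Πi Φ P = begin
      psub (liftPS (sub0 Φ)) (ren (inst []) (ren (wkArgs 0) (pren there P)))
        ≡⟨ cong (psub (liftPS (sub0 Φ))) (trans (ren-inst[] _) (ren-pren (wkArgs 0) there P)) ⟩
      psub (liftPS (sub0 Φ)) (pren there (ren (wkArgs 0) P))
        ≡⟨ psub-pren (liftPS (sub0 Φ)) there (ren (wkArgs 0) P) ⟩
      psub (λ x → liftPS (sub0 Φ) (there x)) (ren (wkArgs 0) P)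
        ≡⟨ psub-idAtom {π = id} wkArgs-idAtom (ren (wkArgs 0) P) ⟩
      pren id (ren (wkArgs 0) P)
        ≡⟨ pren-id (λ _ → refl) (ren (wkArgs 0) P) ⟩
      ren (wkArgs 0) P
        ≡⟨ trans (sym (ren-∘ {ρ = id} (λ _ → refl) P)) (ren-∘ (λ _ → refl) P) ⟩
      ren suc P ∎
      where open ≡-Reasoning

  ∀-elim : ∀ {s} (Φ : Fm s Δ (suc n)) (t : Fin n) → Γ ⊢ all Φ ⊃ ren (sub0i t) Φ
  ∀-elim {s} Φ t = subst (Γ ⊢_) (cong₂ _⊃_ (cong all (θ-instance-under-Πi Φ t)) (ren-∘₃ (sub0i-inst-wkArgs t) Φ))
                                (ΠiE (ΠpE (ax-∀E s) Φ) t)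

  ∃-intro : ∀ {s} (Φ : Fm s Δ (suc n)) (t : Fin n) → Γ ⊢ ren (sub0i t) Φ ⊃ ex Φ
  ∃-intro {s} Φ t = subst (Γ ⊢_) (cong₂ _⊃_ (ren-∘₃ (sub0i-inst-wkArgs t) Φ) (cong ex (θ-instance-under-Πi Φ t)))
                                 (ΠiE (ΠpE (ax-∃I s) Φ) t)

  ∀-intro : ∀ {s} (P : Fm s Δ n) (Φ : Fm s Δ (suc n)) → map (renM suc) Γ ⊢ ren suc P ⊃ Φ → Γ ⊢ P ⊃ all Φ
  ∀-intro {s} P Φ d = ⇒E (subst (Deriv Γ) eq (ΠpE (ΠpE (rule-∀I s) P) Φ)) (ΠiI d)
    where
    eq = cong₂ _⇒_ (cong (Πi ∘ fm) (cong₂ _⊃_ (p-instance-under-Πi Φ P) (θ-instance Φ)))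
                   (cong fm (cong₂ _⊃_ (p-instance Φ P) (cong all (θ-instance Φ))))

  ∃-elim : ∀ {s} (P : Fm s Δ n) (Φ : Fm s Δ (suc n)) → map (renM suc) Γ ⊢ Φ ⊃ ren suc P → Γ ⊢ ex Φ ⊃ P
  ∃-elim {s} P Φ d = ⇒E (subst (Deriv Γ) eq (ΠpE (ΠpE (rule-∃E s) P) Φ)) (ΠiI d)
    where
    eq = cong₂ _⇒_ (cong (Πi ∘ fm) (cong₂ _⊃_ (θ-instance Φ) (p-instance-under-Πi Φ P)))
                   (cong fm (cong₂ _⊃_ (cong ex (θ-instance Φ)) (p-instance Φ P)))

  ax-¿∃ : (Φ : Fm I Δ (suc n)) → Γ ⊢ ¿ ex Φ ⇔' ex (¿ Φ)
  ax-¿∃ Φ = subst (Γ ⊢_) (cong (λ Ψ → ¿ ex Ψ ⇔' ex (¿ Ψ)) (θ-instance Φ)) (ΠpE (ax 44) Φ)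

  ax-¿∀ : (Φ : Fm I Δ (suc n)) → Γ ⊢ ¿ all Φ ⊃ all (¿ Φ)
  ax-¿∀ Φ = subst (Γ ⊢_) (cong (λ Ψ → ¿ all Ψ ⊃ all (¿ Ψ)) (θ-instance Φ)) (ΠpE (ax 45) Φ)

module Quantifiers {Δ n} {Γ : List (MF Δ n)} (has𝒟 : Has𝒟 Γ) where
  open Propositional has𝒟
  open QuantifierRules has𝒟 public
  private
    module Propositional⁺ = Propositional (Has𝒟-renM has𝒟)
    module QuantifierRules⁺ = QuantifierRules (Has𝒟-renM has𝒟)

  ren-sub0i-zero-liftR-suc : ∀ {s} (Φ : Fm s Δ (suc n)) → ren (sub0i zero) (ren (liftR suc) Φ) ≡ Φ
  ren-sub0i-zero-liftR-suc = ren-∘-id sub0i-zero-liftR-suc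

  ∃-intro₀ : ∀ {s} (Φ : Fm s Δ (suc n)) → map (renM suc) Γ ⊢ Φ ⊃ ren suc (ex Φ)
  ∃-intro₀ Φ = subst (λ Ψ → map (renM suc) Γ ⊢ Ψ ⊃ ex (ren (liftR suc) Φ))
                     (ren-sub0i-zero-liftR-suc Φ) (QuantifierRules⁺.∃-intro (ren (liftR suc) Φ) zero)

  ∀-elim₀ : ∀ {s} (Φ : Fm s Δ (suc n)) → map (renM suc) Γ ⊢ ren suc (all Φ) ⊃ Φ
  ∀-elim₀ Φ = subst (λ Ψ → map (renM suc) Γ ⊢ all (ren (liftR suc) Φ) ⊃ Ψ)
                    (ren-sub0i-zero-liftR-suc Φ) (QuantifierRules⁺.∀-elim (ren (liftR suc) Φ) zero)

  ∀-mono : ∀ {s} {X Y : Fm s Δ (suc n)} → map (renM suc) Γ ⊢ X ⊃ Y → Γ ⊢ all X ⊃ all Y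
  ∀-mono {X = X} {Y} d = ∀-intro (all X) Y (Propositional⁺.⊃-trans (∀-elim₀ X) d)

  ∃-mono : ∀ {s} {X Y : Fm s Δ (suc n)} → map (renM suc) Γ ⊢ X ⊃ Y → Γ ⊢ ex X ⊃ ex Y
  ∃-mono {X = X} {Y} d = ∃-elim (ex Y) X (Propositional⁺.⊃-trans d (∃-intro₀ Y))

  ∀-cong : ∀ {s} {X Y : Fm s Δ (suc n)} → map (renM suc) Γ ⊢ X ⇔' Y → Γ ⊢ all X ⇔' all Y
  ∀-cong d = mk⇔ (∀-mono (Propositional⁺.⇔-to d)) (∀-mono (Propositional⁺.⇔-from d))

  ∃-cong : ∀ {s} {X Y : Fm s Δ (suc n)} → map (renM suc) Γ ⊢ X ⇔' Y → Γ ⊢ ex X ⇔' ex Y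
  ∃-cong d = mk⇔ (∃-mono (Propositional⁺.⇔-to d)) (∃-mono (Propositional⁺.⇔-from d))

-- The modality □◇

module Modal {Δ n} {Γ : List (MF Δ n)} (has𝒟 : Has𝒟 Γ) where
  open Propositional has𝒟 public
  open Quantifiers has𝒟 public

  ¡-intro : {X : Fm C Δ n} → Γ ⊢ X → Γ ⊢ ¡ X
  ¡-intro {X} = ⇒E (rule-¡I X)

  ¿-nec : {Φ : Fm I Δ n} → Γ ⊢ Φ → Γ ⊢ ¿ Φ
  ¿-nec {Φ} d = ⇒E (rule-¡E (¿ Φ)) (mp (ax-¡¿ Φ) d)

  Box-nec : {X : Fm C Δ n} → Γ ⊢ X → Γ ⊢ Box X
  Box-nec = ¿-nec ∘ ¡-intro

  ¿-mono : {Φ Ψ : Fm I Δ n} → Γ ⊢ Φ ⊃ Ψ → Γ ⊢ ¿ Φ ⊃ ¿ Ψ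
  ¿-mono {Φ} {Ψ} f = mp (ax-¿⊃ Φ Ψ) (¿-nec f)

  ¡-mono : {X Y : Fm C Δ n} → Γ ⊢ X ⊃ Y → Γ ⊢ ¡ X ⊃ ¡ Y
  ¡-mono {X} {Y} f = mp (ax-¡⊃ X Y) (¡-intro f)

  Box-mono : {X Y : Fm C Δ n} → Γ ⊢ X ⊃ Y → Γ ⊢ Box X ⊃ Box Y
  Box-mono = ¿-mono ∘ ¡-mono

  Box-K : (X Y : Fm C Δ n) → Γ ⊢ Box (X ⊃ Y) ⊃ (Box X ⊃ Box Y)
  Box-K X Y = ⊃-trans (¿-mono (ax-¡⊃ X Y)) (ax-¿⊃ (¡ X) (¡ Y))

  Box-T : (X : Fm C Δ n) → Γ ⊢ Box X ⊃ X
  Box-T = ax-¿¡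

  Box-4 : (X : Fm C Δ n) → Γ ⊢ Box X ⊃ Box (Box X)
  Box-4 X = ¿-mono (ax-¡¿¡ X)

  Box-∧ : (X Y : Fm C Δ n) → Γ ⊢ (Box X ∧' Box Y) ⊃ Box (X ∧' Y)
  Box-∧ X Y = ⊃-uncurry (⊃-trans (Box-mono (ax-∧I X Y)) (Box-K Y (X ∧' Y)))

  Dia-mono : {X Y : Fm C Δ n} → Γ ⊢ X ⊃ Y → Γ ⊢ Dia X ⊃ Dia Y
  Dia-mono = contraposition ∘ Box-mono ∘ contraposition

  Dia-T : (X : Fm C Δ n) → Γ ⊢ X ⊃ Dia X
  Dia-T X = ¬ᶜ-intro (¬ᶜ-elim (⊃-trans var₀ (Box-T (¬ᶜ X))) (weaken₀ (⊃-refl X)))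

  Dia-Dia : (X : Fm C Δ n) → Γ ⊢ Dia (Dia X) ⊃ Dia X
  Dia-Dia X = contraposition (⊃-trans (Box-4 (¬ᶜ X)) (Box-mono (¬¬ᶜ-intro (Box (¬ᶜ X)))))

  Box-Dia-∧ : (X Y : Fm C Δ n) → Γ ⊢ (Box X ∧' Dia Y) ⊃ Dia (X ∧' Y)
  Box-Dia-∧ X Y = ¬ᶜ-intro (¬ᶜ-elim (weaken₀ (ax-∧ʳ _ _)) □¬Y)
    where
    X⊃¬Y : Γ ⊢ ¬ᶜ (X ∧' Y) ⊃ (X ⊃ ¬ᶜ Y)
    X⊃¬Y = ⊃-curry (¬ᶜ-intro (¬ᶜ-elim (weaken₀ (weaken₀ (⊃-refl _))) (∧-intro (weaken₀ var₀) var₀)))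
    □¬Y = ⊃-ap (⊃-trans var₀ (⊃-trans (Box-mono X⊃¬Y) (Box-K X (¬ᶜ Y)))) (weaken₀ (ax-∧ˡ _ _))

  BoxDia-mono : {X Y : Fm C Δ n} → Γ ⊢ X ⊃ Y → Γ ⊢ BoxDia X ⊃ BoxDia Y
  BoxDia-mono = Box-mono ∘ Dia-mono

  BoxDia-cong : {X Y : Fm C Δ n} → Γ ⊢ X ⇔' Y → Γ ⊢ BoxDia X ⇔' BoxDia Y
  BoxDia-cong d = mk⇔ (BoxDia-mono (⇔-to d)) (BoxDia-mono (⇔-from d))

  BoxDia-idem : (X : Fm C Δ n) → Γ ⊢ BoxDia (BoxDia X) ⇔' BoxDia X
  BoxDia-idem X = mk⇔ (Box-mono (⊃-trans (Dia-mono (Box-T (Dia X))) (Dia-Dia X)))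
                      (⊃-trans (Box-4 (Dia X)) (Box-mono (Dia-T (BoxDia X))))

  BoxDia-⊤ : Γ ⊢ BoxDia ⊤ᶜ ⇔' ⊤ᶜ
  BoxDia-⊤ = mk⇔ (⊃-const ax-⊤) (⊃-const (Box-nec (mp (Dia-T ⊤ᶜ) ax-⊤)))

  BoxDia-⊥ : Γ ⊢ BoxDia ⊥ᶜ ⇔' ⊥ᶜ
  BoxDia-⊥ = mk⇔ (⊃-trans (Box-T (Dia ⊥ᶜ)) (¬ᶜ-elim (⊃-refl _) (⊃-const (Box-nec ¬ᶜ⊥ᶜ)))) (ax-⊥ _)

  BoxDia-nec : {X : Fm C Δ n} → Γ ⊢ X → Γ ⊢ BoxDia X
  BoxDia-nec {X} d = Box-nec (mp (Dia-T X) d)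

  -- Persistent hypotheses can be moved under □ (by Box-∧), which is what lets □◇ be
  -- eliminated in their presence.
  Persistent : Fm C Δ n → Set
  Persistent X = Γ ⊢ X ⊃ Box X

  BoxDia-persistent : (X : Fm C Δ n) → Persistent (BoxDia X)
  BoxDia-persistent X = Box-4 (Dia X)

  ¿-persistent : (Φ : Fm I Δ n) → Persistent (¿ Φ)
  ¿-persistent Φ = ¿-mono (ax-¡¿ Φ)

  ∧-persistent : {X Y : Fm C Δ n} → Persistent X → Persistent Y → Persistent (X ∧' Y)
  ∧-persistent {X} {Y} p q = ⊃-trans (∧-mono p q) (Box-∧ X Y)

  BoxDia-intro : {H Y : Fm C Δ n} → Persistent H → Γ ⊢ H ⊃ Y → Γ ⊢ H ⊃ BoxDia Y
  BoxDia-intro {Y = Y} p f = ⊃-trans p (Box-mono (⊃-trans f (Dia-T Y)))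

  BoxDia-unit : {X : Fm C Δ n} → Persistent X → Γ ⊢ X ⊃ BoxDia X
  BoxDia-unit p = BoxDia-intro p (⊃-refl _)

  BoxDia-bind : {X Y : Fm C Δ n} → Γ ⊢ X ⊃ BoxDia Y → Γ ⊢ BoxDia X ⊃ BoxDia Y
  BoxDia-bind {Y = Y} f = ⊃-trans (BoxDia-mono f) (⇔-to (BoxDia-idem Y))

  BoxDia-bind-under : {H X Y : Fm C Δ n} → Persistent H →
                      Γ ⊢ (H ∧' X) ⊃ BoxDia Y → Γ ⊢ (H ∧' BoxDia X) ⊃ BoxDia Y
  BoxDia-bind-under {H} {X} p f =
    ⊃-trans (⊃-trans (∧-mono (⊃-trans p (Box-4 H)) (⊃-refl _)) (Box-∧ (Box H) (Dia X)))
            (⊃-trans (Box-mono (Box-Dia-∧ H X)) (BoxDia-bind f))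

  BoxDia-∧ : {X Y : Fm C Δ n} → Persistent X → Persistent Y → Γ ⊢ (BoxDia X ∧' BoxDia Y) ⊃ BoxDia (X ∧' Y)
  BoxDia-∧ {X} p q = BoxDia-bind-under (BoxDia-persistent X)
                       (⊃-trans ∧-comm (BoxDia-bind-under q (BoxDia-intro (∧-persistent q p) ∧-comm)))

  BoxDia-mp : {X Y : Fm C Δ n} → Persistent X → Γ ⊢ (X ∧' BoxDia (X ⊃ BoxDia Y)) ⊃ BoxDia Y
  BoxDia-mp p = BoxDia-bind-under p (⊃-ap var₀ (ax-∧ˡ _ _))

  BoxDia-mp-under : {H X Y : Fm C Δ n} → Persistent X →
                    Γ ⊢ H ⊃ BoxDia (X ⊃ BoxDia Y) → Γ ⊢ (H ∧' X) ⊃ BoxDia Y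
  BoxDia-mp-under p f = ⊃-trans (∧-intro var₀ (weaken₀ f)) (BoxDia-mp p)

  BoxDia-⊃-elim : {X Y : Fm C Δ n} → Persistent X → Γ ⊢ BoxDia (X ⊃ BoxDia Y) → Γ ⊢ X ⊃ BoxDia Y
  BoxDia-⊃-elim p d = ⊃-trans (∧-intro (⊃-refl _) (⊃-const d)) (BoxDia-mp p)

  ¿-cong : {Φ Ψ : Fm I Δ n} → Γ ⊢ Φ ⇔' Ψ → Γ ⊢ ¿ Φ ⇔' ¿ Ψ
  ¿-cong d = mk⇔ (¿-mono (⇔-to d)) (¿-mono (⇔-from d))

  ¡-cong : {X Y : Fm C Δ n} → Γ ⊢ X ⇔' Y → Γ ⊢ ¡ X ⇔' ¡ Y
  ¡-cong d = mk⇔ (¡-mono (⇔-to d)) (¡-mono (⇔-from d))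

  BoxDia-◇-stable : (X : Fm C Δ n) → Γ ⊢ BoxDia (X ◇) ⇔' (X ◇)
  BoxDia-◇-stable ⊤ᶜ          = BoxDia-⊤
  BoxDia-◇-stable ⊥ᶜ          = BoxDia-⊥
  BoxDia-◇-stable (atom x ts) = BoxDia-idem _
  BoxDia-◇-stable (¿ X)       = BoxDia-idem _
  BoxDia-◇-stable (bin o X Y) = BoxDia-idem _
  BoxDia-◇-stable (¬ᶜ X)      = BoxDia-idem _
  BoxDia-◇-stable (all X)     = BoxDia-idem _
  BoxDia-◇-stable (ex X)      = BoxDia-idem _

-- Translation and substitution

-- Substituting Φ◇ for a c-variable p turns the translated atom □◇p(t) into □◇(Φ◇(t)), which is
-- only provably equivalent to Φ(t)◇; the equivalence must survive the renamings of predicate and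
-- individual variables met when the substitution is pushed under binders.
TranslatesFm : ∀ {Δ m} (s : Sort) → Fm s Δ m → Fm s Δ m → Set
TranslatesFm I A B = A ≡ B ◇
TranslatesFm {Δ} {m} C A B =
  ∀ {Δ'} (π : PRen Δ Δ') {m'} (ρ : Fin m → Fin m') {Γ : List (MF Δ' m')} → Has𝒟 Γ →
  Γ ⊢ BoxDia (ren ρ (pren π A)) ⇔' (ren ρ (pren π B) ◇)

Translates : ∀ {Δ Δ' n} → PSub Δ Δ' n → PSub Δ Δ' n → Set
Translates {Δ} σ₁ σ₂ = ∀ {s k} (x : Δ ∋ (s , k)) → TranslatesFm s (σ₁ x) (σ₂ x)

Translates-liftPS : ∀ {Δ Δ' n} {σ₁ σ₂ : PSub Δ Δ' n} →
                    Translates σ₁ σ₂ → Translates (liftPS σ₁) (liftPS σ₂)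
Translates-liftPS r {I} {k} x = trans (cong (ren (wkArgs k)) (r x)) (sym (◇-ren (wkArgs k) _))
Translates-liftPS {σ₁ = σ₁} {σ₂} r {C} {k} x π ρ {Γ} has𝒟 =
  subst₂ (λ X Y → Γ ⊢ BoxDia X ⇔' (Y ◇)) (ren-under (σ₁ x)) (ren-under (σ₂ x))
         (r x π (ρ ∘ wkArgs k) has𝒟)
  where
  ren-under : ∀ Φ → ren (ρ ∘ wkArgs k) (pren π Φ) ≡ ren ρ (pren π (ren (wkArgs k) Φ))
  ren-under Φ = trans (sym (ren-∘ (λ _ → refl) (pren π Φ))) (cong (ren ρ) (ren-pren (wkArgs k) π Φ))

Translates-liftPSp : ∀ {Δ Δ' n s' k'} {σ₁ σ₂ : PSub Δ Δ' n} →
                     Translates σ₁ σ₂ → Translates (liftPSp {y = (s' , k')} σ₁) (liftPSp σ₂)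
Translates-liftPSp {s' = I} r here               = refl
Translates-liftPSp {s' = C} r here π ρ has𝒟      = Propositional.⇔-refl has𝒟 _
Translates-liftPSp r {I} (there x)               = trans (cong (pren there) (r x)) (sym (◇-pren there _))
Translates-liftPSp {σ₁ = σ₁} {σ₂} r {C} (there x) π ρ {Γ} has𝒟 =
  subst₂ (λ X Y → Γ ⊢ BoxDia (ren ρ X) ⇔' (ren ρ Y ◇))
         (sym (pren-∘ (λ _ → refl) (σ₁ x))) (sym (pren-∘ (λ _ → refl) (σ₂ x)))
         (r x (π ∘ there) ρ has𝒟)

Translates-sub0 : ∀ {s k Δ n} (Φ : Fm s Δ (k + n)) → Translates (sub0 {s} {k} {Δ} {n} (Φ ◇)) (sub0 Φ)
Translates-sub0 {I} Φ here                    = refl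
Translates-sub0 {C} Φ here π ρ {Γ} has𝒟       =
  subst (λ Y → Γ ⊢ BoxDia Y ⇔' (ren ρ (pren π Φ) ◇))
        (trans (◇-ren ρ (pren π Φ)) (cong (ren ρ) (◇-pren π Φ)))
        (Modal.BoxDia-◇-stable has𝒟 (ren ρ (pren π Φ)))
Translates-sub0 Φ {I} (there x)               = refl
Translates-sub0 Φ {C} (there x) π ρ has𝒟      = Propositional.⇔-refl has𝒟 _

private module QHC = Modal

psub-◇ : ∀ {s Δ Δ' n} (σ₁ σ₂ : PSub Δ Δ' n) → Translates σ₁ σ₂ → (A : Fm s Δ n) →
       ∀ {Γ : List (MF Δ' n)} → Has𝒟 Γ → Γ ⊢ psub σ₁ (A ◇) ⇔' (psub σ₂ A ◇)
psub-◇ σ₁ σ₂ r ⊤ᶜ h = QHC.⇔-refl h _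
psub-◇ σ₁ σ₂ r ⊥ᶜ h = QHC.⇔-refl h _
psub-◇ σ₁ σ₂ r ✓  h = QHC.⇔-refl h _
psub-◇ σ₁ σ₂ r ⋏  h = QHC.⇔-refl h _
psub-◇ σ₁ σ₂ r (atom {C} x ts) {Γ} h =
  subst₂ (λ X Y → Γ ⊢ BoxDia (ren (inst ts) X) ⇔' (ren (inst ts) Y ◇))
         (pren-id (λ _ → refl) (σ₁ x)) (pren-id (λ _ → refl) (σ₂ x)) (r x id (inst ts) h)
psub-◇ σ₁ σ₂ r (atom {I} x ts) h rewrite r x | ◇-ren (inst ts) (σ₂ x) = QHC.⇔-refl h _
psub-◇ σ₁ σ₂ r (¿ A)         h = QHC.BoxDia-cong h (QHC.¿-cong h (psub-◇ σ₁ σ₂ r A h))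
psub-◇ σ₁ σ₂ r (¡ A)         h = QHC.¡-cong h (psub-◇ σ₁ σ₂ r A h)
psub-◇ σ₁ σ₂ r (bin {C} o A B) h =
  QHC.BoxDia-cong h (QHC.bin-cong h o (psub-◇ σ₁ σ₂ r A h) (psub-◇ σ₁ σ₂ r B h))
psub-◇ σ₁ σ₂ r (bin {I} o A B) h = QHC.bin-cong h o (psub-◇ σ₁ σ₂ r A h) (psub-◇ σ₁ σ₂ r B h)
psub-◇ σ₁ σ₂ r (¬ᶜ A)        h = QHC.BoxDia-cong h (QHC.¬ᶜ-cong h (psub-◇ σ₁ σ₂ r A h))
psub-◇ σ₁ σ₂ r (all {C} A) h =
  QHC.BoxDia-cong h (QHC.∀-cong h (psub-◇ (liftPS σ₁) (liftPS σ₂) (Translates-liftPS r) A (Has𝒟-renM h)))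
psub-◇ σ₁ σ₂ r (all {I} A) h =
  QHC.∀-cong h (psub-◇ (liftPS σ₁) (liftPS σ₂) (Translates-liftPS r) A (Has𝒟-renM h))
psub-◇ σ₁ σ₂ r (ex {C} A) h =
  QHC.BoxDia-cong h (QHC.∃-cong h (psub-◇ (liftPS σ₁) (liftPS σ₂) (Translates-liftPS r) A (Has𝒟-renM h)))
psub-◇ σ₁ σ₂ r (ex {I} A) h =
  QHC.∃-cong h (psub-◇ (liftPS σ₁) (liftPS σ₂) (Translates-liftPS r) A (Has𝒟-renM h))

module _ {Δ n} {Γ : List (MF Δ n)} where

  fm-mono : ∀ {s} {A B : Fm s Δ n} → Has𝒟 Γ → Γ ⊢ A ⊃ B → Deriv Γ (fm A ⇒ fm B)
  fm-mono has𝒟 f = ⇒I (Propositional.mp (there has𝒟) (Deriv-weaken₁ f) (hyp (here refl)))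

  &-mono : ∀ {M M' N N'} → Deriv Γ (M ⇒ M') → Deriv Γ (N ⇒ N') → Deriv Γ (M & N ⇒ M' & N')
  &-mono f g = ⇒I (&I (⇒E (Deriv-weaken₁ f) (&E₁ (hyp (here refl))))
                      (⇒E (Deriv-weaken₁ g) (&E₂ (hyp (here refl)))))

  ⇒-mono : ∀ {M M' N N'} → Deriv Γ (M' ⇒ M) → Deriv Γ (N ⇒ N') → Deriv Γ ((M ⇒ N) ⇒ (M' ⇒ N'))
  ⇒-mono f g = ⇒I (⇒I (⇒E (weaken₂ g) (⇒E (hyp (there (here refl))) (⇒E (weaken₂ f) (hyp (here refl))))))
    where
    weaken₂ : ∀ {K L K'} → Deriv Γ K → Deriv (L ∷ K' ∷ Γ) K
    weaken₂ = Deriv-weaken₁ ∘ Deriv-weaken₁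

Πi-mono : ∀ {Δ n} {M N : MF Δ (suc n)} → (∀ {Γ'} → Has𝒟 Γ' → Deriv Γ' (M ⇒ N)) →
          ∀ {Γ : List (MF Δ n)} → Has𝒟 Γ → Deriv Γ (Πi M ⇒ Πi N)
Πi-mono f has𝒟 = ⇒I (ΠiI (⇒E (f (Has𝒟-renM (there has𝒟))) (ΠiE-fresh (hyp (here refl)))))

Πp-mono : ∀ {Δ n s k} {M N : MF ((s , k) ∷ Δ) n} → (∀ {Γ'} → Has𝒟 Γ' → Deriv Γ' (M ⇒ N)) →
          ∀ {Γ : List (MF Δ n)} → Has𝒟 Γ → Deriv Γ (Πp s k M ⇒ Πp s k N)
Πp-mono {M = M} f has𝒟 =
  ⇒I (ΠpI (⇒E (f (Has𝒟-prenM (there has𝒟)))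
              (subst (Deriv _) fresh (ΠpE (hyp (here refl)) (idAtom here)))))
  where
  fresh : psubM (sub0 (idAtom here)) (prenM (liftPR there) M) ≡ M
  fresh = trans (psubM-prenM (sub0 (idAtom here)) (liftPR there) M)
                (trans (psubM-idAtom {π = id} (λ { here → refl ; (there x) → refl }) M)
                       (prenM-id (λ _ → refl) M))

psubM-◇ : ∀ {Δ Δ' n} (σ₁ σ₂ : PSub Δ Δ' n) → Translates σ₁ σ₂ → (M : MF Δ n) →
          ∀ {Γ : List (MF Δ' n)} → Has𝒟 Γ →
          Deriv Γ (psubM σ₁ (◇M M) ⇒ ◇M (psubM σ₂ M)) × Deriv Γ (◇M (psubM σ₂ M) ⇒ psubM σ₁ (◇M M))
psubM-◇ σ₁ σ₂ r (fm A) h =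
  let A◇≈ = psub-◇ σ₁ σ₂ r A h in fm-mono h (QHC.⇔-to h A◇≈) , fm-mono h (QHC.⇔-from h A◇≈)
psubM-◇ σ₁ σ₂ r (M & N) h =
  let (M→ , M←) = psubM-◇ σ₁ σ₂ r M h ; (N→ , N←) = psubM-◇ σ₁ σ₂ r N h
  in  &-mono M→ N→ , &-mono M← N←
psubM-◇ σ₁ σ₂ r (M ⇒ N) h =
  let (M→ , M←) = psubM-◇ σ₁ σ₂ r M h ; (N→ , N←) = psubM-◇ σ₁ σ₂ r N h
  in  ⇒-mono M← N→ , ⇒-mono M→ N←
psubM-◇ σ₁ σ₂ r (Πi M) h =
  Πi-mono (proj₁ ∘ psubM-◇ (liftPS σ₁) (liftPS σ₂) (Translates-liftPS r) M) h ,
  Πi-mono (proj₂ ∘ psubM-◇ (liftPS σ₁) (liftPS σ₂) (Translates-liftPS r) M) h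
psubM-◇ σ₁ σ₂ r (Πp s k M) h =
  Πp-mono (proj₁ ∘ psubM-◇ (liftPSp σ₁) (liftPSp σ₂) (Translates-liftPSp r) M) h ,
  Πp-mono (proj₂ ∘ psubM-◇ (liftPSp σ₁) (liftPSp σ₂) (Translates-liftPSp r) M) h

◇-Deriv : ∀ {Δ n} {Γ : List (MF Δ n)} {M} → Deriv Γ M → Deriv (𝒟 ∷ map ◇M Γ) (◇M M)
◇-Deriv (hyp i)   = hyp (there (∈-map⁺ ◇M i))
◇-Deriv (&I d e)  = &I (◇-Deriv d) (◇-Deriv e)
◇-Deriv (&E₁ d)   = &E₁ (◇-Deriv d)
◇-Deriv (&E₂ d)   = &E₂ (◇-Deriv d)
◇-Deriv (⇒I d)    = ⇒I (Deriv-weaken (⊆-reflexive-↭ (↭-swap _ _ ↭-refl)) (◇-Deriv d))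
◇-Deriv (⇒E d e)  = ⇒E (◇-Deriv d) (◇-Deriv e)
◇-Deriv {Γ = Γ} (ΠiI d) =
  ΠiI (subst (λ Γ' → Deriv (𝒟 ∷ Γ') _) (map-commute (◇M-renM suc) Γ) (◇-Deriv d))
◇-Deriv (ΠiE {M = M} d t) = subst (Deriv _) (sym (◇M-renM (sub0i t) M)) (ΠiE (◇-Deriv d) t)
◇-Deriv {Γ = Γ} (ΠpI d) =
  ΠpI (subst (λ Γ' → Deriv (𝒟 ∷ Γ') _) (map-commute (◇M-prenM there) Γ) (◇-Deriv d))
◇-Deriv (ΠpE {M = M} d Φ) =
  ⇒E (proj₁ (psubM-◇ (sub0 (Φ ◇)) (sub0 Φ) (Translates-sub0 Φ) M (here refl))) (ΠpE (◇-Deriv d) (Φ ◇))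

-- Translated axioms

module TranslatedAxioms {Δ n} {Γ : List (MF Δ n)} (has𝒟 : Has𝒟 Γ) where
  open Modal has𝒟
  private
    module Modal⁺ = Modal (Has𝒟-renM has𝒟)

  ◇-K : (p q : Fm C Δ n) → Γ ⊢ BoxDia (BoxDia p ⊃ BoxDia (BoxDia q ⊃ BoxDia p))
  ◇-K p q = BoxDia-nec (BoxDia-intro (BoxDia-persistent p) (ax-K _ _))

  ◇-S : (p q r : Fm C Δ n) →
        Γ ⊢ BoxDia (BoxDia (BoxDia p ⊃ BoxDia (BoxDia q ⊃ BoxDia r)) ⊃
                    BoxDia (BoxDia (BoxDia p ⊃ BoxDia q) ⊃ BoxDia (BoxDia p ⊃ BoxDia r)))
  ◇-S p q r = BoxDia-nec (BoxDia-intro (BoxDia-persistent _) (⊃-curry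
                (BoxDia-intro (∧-persistent (BoxDia-persistent _) (BoxDia-persistent _)) (⊃-curry r-holds))))
    where
    pqr pq : Fm C Δ n
    pqr = BoxDia (BoxDia p ⊃ BoxDia (BoxDia q ⊃ BoxDia r))
    pq  = BoxDia (BoxDia p ⊃ BoxDia q)
    r-holds : Γ ⊢ ((pqr ∧' pq) ∧' BoxDia p) ⊃ BoxDia r
    r-holds = ⊃-trans (∧-intro (BoxDia-mp-under (BoxDia-persistent p) (∧-elimʳ (⊃-refl _)))
                               (BoxDia-mp-under (BoxDia-persistent p) (∧-elimˡ (⊃-refl _))))
                      (BoxDia-mp (BoxDia-persistent q))

  ◇-∧ˡ : (p q : Fm C Δ n) → Γ ⊢ BoxDia (BoxDia (BoxDia p ∧' BoxDia q) ⊃ BoxDia p)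
  ◇-∧ˡ p q = BoxDia-nec (BoxDia-bind (ax-∧ˡ _ _))

  ◇-∧ʳ : (p q : Fm C Δ n) → Γ ⊢ BoxDia (BoxDia (BoxDia p ∧' BoxDia q) ⊃ BoxDia q)
  ◇-∧ʳ p q = BoxDia-nec (BoxDia-bind (ax-∧ʳ _ _))

  ◇-∧I : (p q : Fm C Δ n) → Γ ⊢ BoxDia (BoxDia p ⊃ BoxDia (BoxDia q ⊃ BoxDia (BoxDia p ∧' BoxDia q)))
  ◇-∧I p q = BoxDia-nec (BoxDia-intro (BoxDia-persistent p)
               (⊃-curry (BoxDia-intro (∧-persistent (BoxDia-persistent p) (BoxDia-persistent q)) (⊃-refl _))))

  ◇-∨ˡ : (p q : Fm C Δ n) → Γ ⊢ BoxDia (BoxDia p ⊃ BoxDia (BoxDia p ∨' BoxDia q))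
  ◇-∨ˡ p q = BoxDia-nec (BoxDia-intro (BoxDia-persistent p) (ax-∨ˡ _ _))

  ◇-∨ʳ : (p q : Fm C Δ n) → Γ ⊢ BoxDia (BoxDia q ⊃ BoxDia (BoxDia p ∨' BoxDia q))
  ◇-∨ʳ p q = BoxDia-nec (BoxDia-intro (BoxDia-persistent q) (ax-∨ʳ _ _))

  ◇-∨E : (p q r : Fm C Δ n) →
         Γ ⊢ BoxDia (BoxDia (BoxDia p ⊃ BoxDia r) ⊃
                     BoxDia (BoxDia (BoxDia q ⊃ BoxDia r) ⊃ BoxDia (BoxDia (BoxDia p ∨' BoxDia q) ⊃ BoxDia r)))
  ◇-∨E p q r = BoxDia-nec (BoxDia-intro (BoxDia-persistent _) (⊃-curry (BoxDia-intro prs (⊃-curry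
                 (BoxDia-bind-under prs (∨-elim var₀ (case p (∧-elimˡ (⊃-refl H))) (case q (∧-elimʳ (⊃-refl H)))))))))
    where
    H : Fm C Δ n
    H = BoxDia (BoxDia p ⊃ BoxDia r) ∧' BoxDia (BoxDia q ⊃ BoxDia r)
    prs : Persistent H
    prs = ∧-persistent (BoxDia-persistent _) (BoxDia-persistent _)
    case : (x : Fm C Δ n) → Γ ⊢ H ⊃ BoxDia (BoxDia x ⊃ BoxDia r) →
           Γ ⊢ ((H ∧' (BoxDia p ∨' BoxDia q)) ∧' BoxDia x) ⊃ BoxDia r
    case x x⊃r = BoxDia-mp-under (BoxDia-persistent x) (weaken₀ x⊃r)

  ◇-⊥ : (p : Fm C Δ n) → Γ ⊢ BoxDia (⊥ᶜ ⊃ BoxDia p)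
  ◇-⊥ p = BoxDia-nec (ax-⊥ _)

  ◇-⇔⊃ : (p q : Fm C Δ n) → Γ ⊢ BoxDia (BoxDia (BoxDia p ⇔' BoxDia q) ⊃ BoxDia (BoxDia p ⊃ BoxDia q))
  ◇-⇔⊃ p q = BoxDia-nec (BoxDia-mono (ax-⇔⊃ _ _))

  ◇-⇔⊂ : (p q : Fm C Δ n) → Γ ⊢ BoxDia (BoxDia (BoxDia p ⇔' BoxDia q) ⊃ BoxDia (BoxDia q ⊃ BoxDia p))
  ◇-⇔⊂ p q = BoxDia-nec (BoxDia-mono (ax-⇔⊂ _ _))

  ◇-⇔I : (p q : Fm C Δ n) →
         Γ ⊢ BoxDia (BoxDia (BoxDia p ⊃ BoxDia q) ⊃
                     BoxDia (BoxDia (BoxDia q ⊃ BoxDia p) ⊃ BoxDia (BoxDia p ⇔' BoxDia q)))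
  ◇-⇔I p q = BoxDia-nec (BoxDia-intro (BoxDia-persistent _) (⊃-curry
               (BoxDia-intro (∧-persistent (BoxDia-persistent _) (BoxDia-persistent _))
                             (⇔-intro (⊃-curry (BoxDia-mp-under (BoxDia-persistent p) (∧-elimˡ (⊃-refl _))))
                                      (⊃-curry (BoxDia-mp-under (BoxDia-persistent q) (∧-elimʳ (⊃-refl _))))))))

  ◇-mp : (p q : Fm C Δ n) → Deriv Γ ((fm (BoxDia p) & fm (BoxDia (BoxDia p ⊃ BoxDia q))) ⇒ fm (BoxDia q))
  ◇-mp p q = ⇒I (Modal′.mp (Modal′.BoxDia-mp (Modal′.BoxDia-persistent p))
                           (Modal′.mp (Modal′.mp (Modal′.ax-∧I _ _) (&E₁ (hyp (here refl))))
                                      (&E₂ (hyp (here refl)))))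
    where
    module Modal′ = Modal (there has𝒟)

  ◇-∀E : (Φ : Fm C Δ (suc n)) (t : Fin n) →
         Γ ⊢ BoxDia (BoxDia (all (BoxDia Φ)) ⊃ BoxDia (ren (sub0i t) Φ))
  ◇-∀E Φ t = BoxDia-nec (BoxDia-bind (∀-elim (BoxDia Φ) t))

  ◇-∃I : (Φ : Fm C Δ (suc n)) (t : Fin n) →
         Γ ⊢ BoxDia (BoxDia (ren (sub0i t) Φ) ⊃ BoxDia (ex (BoxDia Φ)))
  ◇-∃I Φ t = BoxDia-nec (BoxDia-intro (BoxDia-persistent _) (∃-intro (BoxDia Φ) t))

  ◇-∀I : (P : Fm C Δ n) (Φ : Fm C Δ (suc n)) →
         map (renM suc) Γ ⊢ BoxDia (BoxDia (ren suc P) ⊃ BoxDia Φ) →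
         Γ ⊢ BoxDia (BoxDia P ⊃ BoxDia (all (BoxDia Φ)))
  ◇-∀I P Φ d = BoxDia-nec (BoxDia-intro (BoxDia-persistent P)
                 (∀-intro (BoxDia P) (BoxDia Φ) (Modal⁺.BoxDia-⊃-elim (Modal⁺.BoxDia-persistent _) d)))

  ◇-∃E : (P : Fm C Δ n) (Φ : Fm C Δ (suc n)) →
         map (renM suc) Γ ⊢ BoxDia (BoxDia Φ ⊃ BoxDia (ren suc P)) →
         Γ ⊢ BoxDia (BoxDia (ex (BoxDia Φ)) ⊃ BoxDia P)
  ◇-∃E P Φ d = BoxDia-nec (BoxDia-bind
                 (∃-elim (BoxDia P) (BoxDia Φ) (Modal⁺.BoxDia-⊃-elim (Modal⁺.BoxDia-persistent _) d)))

  ◇-¬¬ : (p : Fm C Δ n) → Γ ⊢ BoxDia (BoxDia (¬ᶜ BoxDia (¬ᶜ BoxDia p)) ⊃ BoxDia p)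
  ◇-¬¬ p = BoxDia-nec (⊃-trans (BoxDia-mono ¬□◇¬⊃◇)
                               (⊃-trans (Box-mono (Dia-Dia (BoxDia p))) (⇔-to (BoxDia-idem p))))
    where
    ¬□◇¬⊃◇ : Γ ⊢ ¬ᶜ BoxDia (¬ᶜ BoxDia p) ⊃ Dia (BoxDia p)
    ¬□◇¬⊃◇ = ⊃-trans (contraposition (Box-mono (ax-¬¬ (Dia (¬ᶜ BoxDia p)))))
                     (Dia-mono (⊃-trans (⊃-trans (ax-¬¬ _) (Box-mono (ax-¬¬ (BoxDia p)))) (Box-T (BoxDia p))))

  ◇-¬E : (p : Fm C Δ n) → Γ ⊢ BoxDia (BoxDia (¬ᶜ BoxDia p) ⊃ BoxDia (BoxDia p ⊃ ⊥ᶜ))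
  ◇-¬E p = BoxDia-nec (BoxDia-intro (BoxDia-persistent _) (⊃-curry (⊃-trans ∧-comm
             (⊃-trans (BoxDia-bind-under (BoxDia-persistent p) (⊥ₛ-elim (¬ᶜ-elim var₀ (ax-∧ˡ _ _))))
                      (⇔-to BoxDia-⊥)))))

  ◇-¬I : (p : Fm C Δ n) → Γ ⊢ BoxDia (BoxDia (BoxDia p ⊃ ⊥ᶜ) ⊃ BoxDia (¬ᶜ BoxDia p))
  ◇-¬I p = BoxDia-nec (BoxDia-intro (BoxDia-persistent _) (¬ᶜ-intro (⊃-trans ∧-comm
             (⊃-trans (BoxDia-bind-under (BoxDia-persistent p) (⊥ₛ-elim (⊃-ap var₀ (∧-elimˡ (⊃-refl _)))))
                      (⇔-to BoxDia-⊥)))))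

  ◇-¿∧ : (γ δ : Fm I Δ n) → Γ ⊢ BoxDia (BoxDia (¿ (γ ∧' δ)) ⇔' BoxDia (BoxDia (¿ γ) ∧' BoxDia (¿ δ)))
  ◇-¿∧ γ δ = BoxDia-nec (mk⇔
    (BoxDia-bind (BoxDia-intro (¿-persistent _)
      (⊃-trans (⇔-to (ax-¿∧ γ δ)) (∧-mono (BoxDia-unit (¿-persistent γ)) (BoxDia-unit (¿-persistent δ))))))
    (BoxDia-bind (⊃-trans (BoxDia-∧ (¿-persistent γ) (¿-persistent δ)) (BoxDia-mono (⇔-from (ax-¿∧ γ δ))))))

  ◇-¿∨ : (γ δ : Fm I Δ n) → Γ ⊢ BoxDia (BoxDia (¿ (γ ∨' δ)) ⇔' BoxDia (BoxDia (¿ γ) ∨' BoxDia (¿ δ)))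
  ◇-¿∨ γ δ = BoxDia-nec (mk⇔
    (BoxDia-bind (BoxDia-intro (¿-persistent _)
      (⊃-trans (⇔-to (ax-¿∨ γ δ)) (∨-mono (BoxDia-unit (¿-persistent γ)) (BoxDia-unit (¿-persistent δ))))))
    (BoxDia-bind (∨-elim (⊃-refl _) (⊃-trans var₀ (BoxDia-mono (¿-mono (ax-∨ˡ γ δ))))
                                    (⊃-trans var₀ (BoxDia-mono (¿-mono (ax-∨ʳ γ δ)))))))

  ◇-¿⊃ : (γ δ : Fm I Δ n) → Γ ⊢ BoxDia (BoxDia (¿ (γ ⊃ δ)) ⊃ BoxDia (BoxDia (¿ γ) ⊃ BoxDia (¿ δ)))
  ◇-¿⊃ γ δ = BoxDia-nec (BoxDia-intro (BoxDia-persistent _) (⊃-curry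
    (⊃-trans (BoxDia-∧ (¿-persistent _) (¿-persistent γ))
             (BoxDia-bind (⊃-trans (⊃-uncurry (ax-¿⊃ γ δ)) (BoxDia-unit (¿-persistent δ)))))))

  ◇-¬¿⋏ : Γ ⊢ BoxDia (¬ᶜ BoxDia (¿ ⋏))
  ◇-¬¿⋏ = BoxDia-nec (mp (ax-¬I _) (⊃-trans (BoxDia-bind (⊃-trans (mp (ax-¬E _) ax-¬¿⋏) (ax-⊥ _)))
                                            (⇔-to BoxDia-⊥)))

  ◇-¿∃ : (Φ : Fm I Δ (suc n)) → Γ ⊢ BoxDia (BoxDia (¿ (ex Φ)) ⇔' BoxDia (ex (BoxDia (¿ Φ))))
  ◇-¿∃ Φ = BoxDia-nec (mk⇔
    (BoxDia-bind (BoxDia-intro (¿-persistent _)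
      (⊃-trans (⇔-to (ax-¿∃ Φ)) (∃-mono (Modal⁺.BoxDia-unit (Modal⁺.¿-persistent Φ))))))
    (BoxDia-bind (∃-elim (BoxDia (¿ ex Φ)) (BoxDia (¿ Φ)) (Modal⁺.BoxDia-mono (Modal⁺.¿-mono (∃-intro₀ Φ))))))

  ◇-¿∀ : (Φ : Fm I Δ (suc n)) → Γ ⊢ BoxDia (BoxDia (¿ all Φ) ⊃ BoxDia (all (BoxDia (¿ Φ))))
  ◇-¿∀ Φ = BoxDia-nec (BoxDia-bind (BoxDia-intro (¿-persistent _)
    (⊃-trans (ax-¿∀ Φ) (∀-mono (Modal⁺.BoxDia-unit (Modal⁺.¿-persistent Φ))))))

  ◇-¡¿ : (γ : Fm I Δ n) → Γ ⊢ γ ⊃ ¡ (BoxDia (¿ γ))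
  ◇-¡¿ γ = ⊃-trans (ax-¡¿ γ) (¡-mono (BoxDia-unit (¿-persistent γ)))

  ◇-¿¡ : (p : Fm C Δ n) → Γ ⊢ BoxDia (BoxDia (¿ ¡ BoxDia p) ⊃ BoxDia p)
  ◇-¿¡ p = BoxDia-nec (BoxDia-bind (Box-T (BoxDia p)))

  ◇-¡¿¡ : (p : Fm C Δ n) → Γ ⊢ ¡ BoxDia p ⊃ ¡ BoxDia (¿ ¡ BoxDia p)
  ◇-¡¿¡ p = ¡-mono (BoxDia-intro (BoxDia-persistent p) (BoxDia-persistent p))

  ◇-¡⊃ : (p q : Fm C Δ n) → Γ ⊢ ¡ BoxDia (BoxDia p ⊃ BoxDia q) ⊃ (¡ BoxDia p ⊃ ¡ BoxDia q)
  ◇-¡⊃ p q = ⊃-trans (¡-mono (⊃-curry (⊃-trans ∧-comm (BoxDia-mp (BoxDia-persistent p))))) (ax-¡⊃ _ _)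

◇𝒟 : ∀ {Δ n} {Γ : List (MF Δ n)} → Has𝒟 Γ → Deriv Γ (◇M 𝒟)
◇𝒟 h = ⋀-intro {Ms = map ◇M axioms𝒟} (ax 0)
  ( ax 1 ∷ ax 2 ∷ ax 3 ∷ ax 4 ∷ ax 5 ∷ ax 6 ∷ ax 7 ∷ ax 8 ∷ ax 9
  ∷ ax 10 ∷ ax 11 ∷ ax 12 ∷ ax 13 ∷ ax 14 ∷ ax 15 ∷ ax 16 ∷ ax 17 ∷ ax 18
  ∷ ΠpI (ΠpI (T.◇-K h₂ #1 #0))
  ∷ ΠpI (ΠpI (ΠpI (T.◇-S h₃ #2 #1 #0)))
  ∷ ΠpI (ΠpI (T.◇-∧ˡ h₂ #1 #0))
  ∷ ΠpI (ΠpI (T.◇-∧ʳ h₂ #1 #0))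
  ∷ ΠpI (ΠpI (T.◇-∧I h₂ #1 #0))
  ∷ ΠpI (ΠpI (T.◇-∨ˡ h₂ #1 #0))
  ∷ ΠpI (ΠpI (T.◇-∨ʳ h₂ #1 #0))
  ∷ ΠpI (ΠpI (ΠpI (T.◇-∨E h₃ #2 #1 #0)))
  ∷ ΠpI (T.◇-⊥ h₁ #0)
  ∷ ax-⊤
  ∷ ΠpI (ΠpI (T.◇-⇔⊃ h₂ #1 #0))
  ∷ ΠpI (ΠpI (T.◇-⇔⊂ h₂ #1 #0))
  ∷ ΠpI (ΠpI (T.◇-⇔I h₂ #1 #0))
  ∷ ΠpI (ΠpI (T.◇-mp h₂ #1 #0))
  ∷ ΠpI (ΠiI (T.◇-∀E (Has𝒟-renM h₁) (θ zero) zero))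
  ∷ ΠpI (ΠiI (T.◇-∃I (Has𝒟-renM h₁) (θ zero) zero))
  ∷ ΠpI (ΠpI (⇒I (T.◇-∀I (there h₂) (atom (there here) []) (θ zero) (ΠiE-fresh (hyp (here refl))))))
  ∷ ΠpI (ΠpI (⇒I (T.◇-∃E (there h₂) (atom (there here) []) (θ zero) (ΠiE-fresh (hyp (here refl))))))
  ∷ ΠpI (T.◇-¬¬ h₁ #0)
  ∷ ΠpI (T.◇-¬E h₁ #0)
  ∷ ΠpI (T.◇-¬I h₁ #0)
  ∷ ΠpI (ΠpI (T.◇-¿∧ h₂ #1 #0))
  ∷ ΠpI (ΠpI (T.◇-¿∨ h₂ #1 #0))
  ∷ ΠpI (ΠpI (T.◇-¿⊃ h₂ #1 #0))
  ∷ T.◇-¬¿⋏ h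
  ∷ ΠpI (T.◇-¿∃ h₁ (θ zero))
  ∷ ΠpI (T.◇-¿∀ h₁ (θ zero))
  ∷ ΠpI (T.◇-¡¿ h₁ #0)
  ∷ ax-¬¡⊥
  ∷ ΠpI (T.◇-¿¡ h₁ #0)
  ∷ ΠpI (T.◇-¡¿¡ h₁ #0)
  ∷ ΠpI (ΠpI (T.◇-¡⊃ h₂ #1 #0))
  ∷ ΠpI (rule-¡E h₁ (BoxDia #0))
  ∷ ΠpI (rule-¡I h₁ (BoxDia #0))
  ∷ [])
  where
  open Axioms h using (ax; ax-⊤; ax-¬¡⊥)
  open Axioms using (rule-¡E; rule-¡I)
  module T = TranslatedAxioms
  h₁ : ∀ {y} → Has𝒟 (map (prenM (there {y = y})) _)
  h₁ = Has𝒟-prenM h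
  h₂ : ∀ {y y'} → Has𝒟 (map (prenM (there {y = y'})) (map (prenM (there {y = y})) _))
  h₂ = Has𝒟-prenM h₁
  h₃ : ∀ {y y' y''} →
       Has𝒟 (map (prenM (there {y = y''})) (map (prenM (there {y = y'})) (map (prenM (there {y = y})) _)))
  h₃ = Has𝒟-prenM h₂

◇-preserves-⊢QHC : ∀ {Δ n s} (As : List (AnyFm Δ n)) (A : Fm s Δ n) →
                   As ⊢QHC A → map ◇Σ As ⊢QHC (A ◇)
◇-preserves-⊢QHC []       A d = ⇒I (⇒E (◇-Deriv d) (◇𝒟 (here refl)))
◇-preserves-⊢QHC (B ∷ Bs) A d =
  ⇒I (subst (λ X → Deriv _ (X ⇒ fm (A ◇))) (◇M-⋀fmΣ B Bs) (⇒E (◇-Deriv d) (◇𝒟 (here refl))))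
  where
  ◇M-⋀fmΣ : ∀ {Δ n} (B : AnyFm Δ n) (Bs : List (AnyFm Δ n)) →
            ◇M (⋀ (fmΣ B) (map fmΣ Bs)) ≡ ⋀ (fmΣ (◇Σ B)) (map fmΣ (map ◇Σ Bs))
  ◇M-⋀fmΣ (s , B) []        = refl
  ◇M-⋀fmΣ (s , B) (B' ∷ Bs) = cong (fm (B ◇) &_) (◇M-⋀fmΣ B' Bs)

-- Erasure

-- A problem variable is erased to ⊤ᶜ (nothing); a proper predicate variable is renamed.
Erasure : PCtx → PCtx → Set
Erasure Δ Δ' = ∀ {s k} → Δ ∋ (s , k) → Maybe (Δ' ∋ (C , k))

liftErasure : ∀ {Δ Δ' s k} → Erasure Δ Δ' → Erasure ((s , k) ∷ Δ) ((C , k) ∷ Δ')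
liftErasure τ here      = just here
liftErasure τ (there x) = Maybe.map there (τ x)

eraseAtom : ∀ {Δ' n k} → Maybe (Δ' ∋ (C , k)) → Vec (Fin n) k → Fm C Δ' n
eraseAtom (just y) ts = atom y ts
eraseAtom nothing  ts = ⊤ᶜ

erase : ∀ {s Δ Δ' n} → Erasure Δ Δ' → Fm s Δ n → Fm C Δ' n
erase τ ⊤ᶜ          = ⊤ᶜ
erase τ ⊥ᶜ          = ⊥ᶜ
erase τ ✓           = ⊤ᶜ
erase τ ⋏           = ⊥ᶜ
erase τ (atom x ts) = eraseAtom (τ x) ts
erase τ (¿ A)       = erase τ A
erase τ (¡ A)       = erase τ A
erase τ (bin o A B) = bin o (erase τ A) (erase τ B)
erase τ (¬ᶜ A)      = ¬ᶜ erase τ A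
erase τ (all A)     = all (erase τ A)
erase τ (ex A)      = ex (erase τ A)

eraseM : ∀ {Δ Δ' n} → Erasure Δ Δ' → MF Δ n → MF Δ' n
eraseM τ (fm A)     = fm (erase τ A)
eraseM τ (M & N)    = eraseM τ M & eraseM τ N
eraseM τ (M ⇒ N)    = eraseM τ M ⇒ eraseM τ N
eraseM τ (Πi M)     = Πi (eraseM τ M)
eraseM τ (Πp s k M) = Πp C k (eraseM (liftErasure τ) M)

erase-ren : ∀ {s Δ Δ' n m} (τ : Erasure Δ Δ') (ρ : Fin n → Fin m) (A : Fm s Δ n) →
            erase τ (ren ρ A) ≡ ren ρ (erase τ A)
erase-ren τ ρ ⊤ᶜ          = refl
erase-ren τ ρ ⊥ᶜ          = refl
erase-ren τ ρ ✓           = refl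
erase-ren τ ρ ⋏           = refl
erase-ren τ ρ (atom x ts) with τ x
... | just y  = refl
... | nothing = refl
erase-ren τ ρ (¿ A)       = erase-ren τ ρ A
erase-ren τ ρ (¡ A)       = erase-ren τ ρ A
erase-ren τ ρ (bin o A B) = cong₂ (bin o) (erase-ren τ ρ A) (erase-ren τ ρ B)
erase-ren τ ρ (¬ᶜ A)      = cong ¬ᶜ_ (erase-ren τ ρ A)
erase-ren τ ρ (all A)     = cong all (erase-ren τ (liftR ρ) A)
erase-ren τ ρ (ex A)      = cong ex (erase-ren τ (liftR ρ) A)

module _ {Δ₁ Δ₂ Δ₁' Δ₂'} (τ : Erasure Δ₁ Δ₁') (τ' : Erasure Δ₂ Δ₂')
         (π : PRen Δ₁ Δ₂) (π' : PRen Δ₁' Δ₂')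
         (square : ∀ {s k} (x : Δ₁ ∋ (s , k)) → τ' (π x) ≡ Maybe.map π' (τ x)) where

  erase-pren : ∀ {s n} (A : Fm s Δ₁ n) → erase τ' (pren π A) ≡ pren π' (erase τ A)
  erase-pren ⊤ᶜ          = refl
  erase-pren ⊥ᶜ          = refl
  erase-pren ✓           = refl
  erase-pren ⋏           = refl
  erase-pren (atom x ts) with τ x | square x
  ... | just y  | eq = cong (λ y' → eraseAtom y' ts) eq
  ... | nothing | eq = cong (λ y' → eraseAtom y' ts) eq
  erase-pren (¿ A)       = erase-pren A
  erase-pren (¡ A)       = erase-pren A
  erase-pren (bin o A B) = cong₂ (bin o) (erase-pren A) (erase-pren B)
  erase-pren (¬ᶜ A)      = cong ¬ᶜ_ (erase-pren A)
  erase-pren (all A)     = cong all (erase-pren A)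
  erase-pren (ex A)      = cong ex (erase-pren A)

erase-pren-there : ∀ {Δ Δ' s k s' n} (τ : Erasure Δ Δ') (A : Fm s' Δ n) →
                   erase (liftErasure {s = s} {k = k} τ) (pren there A) ≡ pren there (erase τ A)
erase-pren-there τ = erase-pren τ (liftErasure τ) there there (λ _ → refl)

eraseM-renM : ∀ {Δ Δ' n m} (τ : Erasure Δ Δ') (ρ : Fin n → Fin m) (M : MF Δ n) →
              eraseM τ (renM ρ M) ≡ renM ρ (eraseM τ M)
eraseM-renM τ ρ (fm A)     = cong fm (erase-ren τ ρ A)
eraseM-renM τ ρ (M & N)    = cong₂ _&_ (eraseM-renM τ ρ M) (eraseM-renM τ ρ N)
eraseM-renM τ ρ (M ⇒ N)    = cong₂ _⇒_ (eraseM-renM τ ρ M) (eraseM-renM τ ρ N)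
eraseM-renM τ ρ (Πi M)     = cong Πi (eraseM-renM τ (liftR ρ) M)
eraseM-renM τ ρ (Πp s k M) = cong (Πp C k) (eraseM-renM (liftErasure τ) ρ M)

eraseM-prenM : ∀ {Δ₁ Δ₂ Δ₁' Δ₂' n} (τ : Erasure Δ₁ Δ₁') (τ' : Erasure Δ₂ Δ₂')
               (π : PRen Δ₁ Δ₂) (π' : PRen Δ₁' Δ₂') →
               (∀ {s k} (x : Δ₁ ∋ (s , k)) → τ' (π x) ≡ Maybe.map π' (τ x)) →
               (M : MF Δ₁ n) → eraseM τ' (prenM π M) ≡ prenM π' (eraseM τ M)
eraseM-prenM τ τ' π π' sq (fm A)     = cong fm (erase-pren τ τ' π π' sq A)
eraseM-prenM τ τ' π π' sq (M & N)    =
  cong₂ _&_ (eraseM-prenM τ τ' π π' sq M) (eraseM-prenM τ τ' π π' sq N)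
eraseM-prenM τ τ' π π' sq (M ⇒ N)    =
  cong₂ _⇒_ (eraseM-prenM τ τ' π π' sq M) (eraseM-prenM τ τ' π π' sq N)
eraseM-prenM τ τ' π π' sq (Πi M)     = cong Πi (eraseM-prenM τ τ' π π' sq M)
eraseM-prenM τ τ' π π' sq (Πp s k M) =
  cong (Πp C k) (eraseM-prenM (liftErasure τ) (liftErasure τ') (liftPR π) (liftPR π') lifted M)
  where
  lifted : ∀ {s' k'} (x : _ ∋ (s' , k')) →
           liftErasure τ' (liftPR π x) ≡ Maybe.map (liftPR π') (liftErasure τ x)
  lifted here      = refl
  lifted (there x) with τ x | sq x
  ... | just y  | eq = cong (Maybe.map there) eq
  ... | nothing | eq = cong (Maybe.map there) eq

ErasesTo : ∀ {Δ₁' Δ₂ Δ₂' n s k} → Erasure Δ₂ Δ₂' → PSub Δ₁' Δ₂' n →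
           Maybe (Δ₁' ∋ (C , k)) → Fm s Δ₂ (k + n) → Set
ErasesTo τ₂ σ' (just y) Φ = σ' y ≡ erase τ₂ Φ
ErasesTo τ₂ σ' nothing  Φ = erase τ₂ Φ ≡ ⊤ᶜ

ErasedSub : ∀ {Δ₁ Δ₁' Δ₂ Δ₂' n} → Erasure Δ₁ Δ₁' → Erasure Δ₂ Δ₂' →
            PSub Δ₁ Δ₂ n → PSub Δ₁' Δ₂' n → Set
ErasedSub {Δ₁} τ₁ τ₂ σ σ' = ∀ {s k} (x : Δ₁ ∋ (s , k)) → ErasesTo τ₂ σ' (τ₁ x) (σ x)

module _ {Δ₁ Δ₁' Δ₂ Δ₂'} (τ₁ : Erasure Δ₁ Δ₁') (τ₂ : Erasure Δ₂ Δ₂') where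

  ErasedSub-liftPS : ∀ {n} (σ : PSub Δ₁ Δ₂ n) (σ' : PSub Δ₁' Δ₂' n) →
                     ErasedSub τ₁ τ₂ σ σ' → ErasedSub τ₁ τ₂ (liftPS σ) (liftPS σ')
  ErasedSub-liftPS σ σ' er {k = k} x with τ₁ x | er x
  ... | just y  | eq = trans (cong (ren (wkArgs k)) eq) (sym (erase-ren τ₂ (wkArgs k) (σ x)))
  ... | nothing | eq = trans (erase-ren τ₂ (wkArgs k) (σ x)) (cong (ren (wkArgs k)) eq)

  ErasedSub-liftPSp : ∀ {n s k} (σ : PSub Δ₁ Δ₂ n) (σ' : PSub Δ₁' Δ₂' n) → ErasedSub τ₁ τ₂ σ σ' →
                      ErasedSub (liftErasure {s = s} {k = k} τ₁) (liftErasure {s = s} {k = k} τ₂)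
                                (liftPSp σ) (liftPSp σ')
  ErasedSub-liftPSp σ σ' er here = refl
  ErasedSub-liftPSp σ σ' er (there x) with τ₁ x | er x
  ... | just y  | eq = trans (cong (pren there) eq) (sym (erase-pren-there τ₂ (σ x)))
  ... | nothing | eq = trans (erase-pren-there τ₂ (σ x)) (cong (pren there) eq)

  erase-psub : ∀ {s n} (σ : PSub Δ₁ Δ₂ n) (σ' : PSub Δ₁' Δ₂' n) → ErasedSub τ₁ τ₂ σ σ' →
               (A : Fm s Δ₁ n) → erase τ₂ (psub σ A) ≡ psub σ' (erase τ₁ A)
  erase-psub σ σ' er ⊤ᶜ = refl
  erase-psub σ σ' er ⊥ᶜ = refl
  erase-psub σ σ' er ✓  = refl
  erase-psub σ σ' er ⋏  = refl
  erase-psub σ σ' er (atom x ts) with τ₁ x | er x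
  ... | just y  | eq = trans (erase-ren τ₂ (inst ts) (σ x)) (cong (ren (inst ts)) (sym eq))
  ... | nothing | eq = trans (erase-ren τ₂ (inst ts) (σ x)) (cong (ren (inst ts)) eq)
  erase-psub σ σ' er (¿ A)       = erase-psub σ σ' er A
  erase-psub σ σ' er (¡ A)       = erase-psub σ σ' er A
  erase-psub σ σ' er (bin o A B) = cong₂ (bin o) (erase-psub σ σ' er A) (erase-psub σ σ' er B)
  erase-psub σ σ' er (¬ᶜ A)      = cong ¬ᶜ_ (erase-psub σ σ' er A)
  erase-psub σ σ' er (all A)     = cong all (erase-psub _ _ (ErasedSub-liftPS σ σ' er) A)
  erase-psub σ σ' er (ex A)      = cong ex (erase-psub _ _ (ErasedSub-liftPS σ σ' er) A)

eraseM-psubM : ∀ {Δ₁ Δ₁' Δ₂ Δ₂' n} (τ₁ : Erasure Δ₁ Δ₁') (τ₂ : Erasure Δ₂ Δ₂')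
               (σ : PSub Δ₁ Δ₂ n) (σ' : PSub Δ₁' Δ₂' n) → ErasedSub τ₁ τ₂ σ σ' →
               (M : MF Δ₁ n) → eraseM τ₂ (psubM σ M) ≡ psubM σ' (eraseM τ₁ M)
eraseM-psubM τ₁ τ₂ σ σ' er (fm A)     = cong fm (erase-psub τ₁ τ₂ σ σ' er A)
eraseM-psubM τ₁ τ₂ σ σ' er (M & N)    =
  cong₂ _&_ (eraseM-psubM τ₁ τ₂ σ σ' er M) (eraseM-psubM τ₁ τ₂ σ σ' er N)
eraseM-psubM τ₁ τ₂ σ σ' er (M ⇒ N)    =
  cong₂ _⇒_ (eraseM-psubM τ₁ τ₂ σ σ' er M) (eraseM-psubM τ₁ τ₂ σ σ' er N)
eraseM-psubM τ₁ τ₂ σ σ' er (Πi M)     =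
  cong Πi (eraseM-psubM τ₁ τ₂ (liftPS σ) (liftPS σ') (ErasedSub-liftPS τ₁ τ₂ σ σ' er) M)
eraseM-psubM τ₁ τ₂ σ σ' er (Πp s k M) =
  cong (Πp C k) (eraseM-psubM (liftErasure τ₁) (liftErasure τ₂) (liftPSp σ) (liftPSp σ')
                              (ErasedSub-liftPSp τ₁ τ₂ σ σ' er) M)

ErasedSub-sub0 : ∀ {Δ Δ' n s k} (τ : Erasure Δ Δ') (Φ : Fm s Δ (k + n)) →
                 ErasedSub (liftErasure {s = s} {k = k} τ) τ (sub0 Φ) (sub0 (erase τ Φ))
ErasedSub-sub0 τ Φ here = refl
ErasedSub-sub0 τ Φ (there x) with τ x in eq
... | just y  = cong (λ y' → eraseAtom y' _) (sym eq)
... | nothing = cong (λ y' → eraseAtom y' _) eq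

erase-Deriv : ∀ {Δ Δ' n} (τ : Erasure Δ Δ') {Γ : List (MF Δ n)} {M} →
              Deriv Γ M → Deriv (map (eraseM τ) Γ) (eraseM τ M)
erase-Deriv τ (hyp i)  = hyp (∈-map⁺ (eraseM τ) i)
erase-Deriv τ (&I d e) = &I (erase-Deriv τ d) (erase-Deriv τ e)
erase-Deriv τ (&E₁ d)  = &E₁ (erase-Deriv τ d)
erase-Deriv τ (&E₂ d)  = &E₂ (erase-Deriv τ d)
erase-Deriv τ (⇒I d)   = ⇒I (erase-Deriv τ d)
erase-Deriv τ (⇒E d e) = ⇒E (erase-Deriv τ d) (erase-Deriv τ e)
erase-Deriv τ {Γ} (ΠiI d) =
  ΠiI (subst (λ Γ' → Deriv Γ' _) (map-commute (eraseM-renM τ suc) Γ) (erase-Deriv τ d))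
erase-Deriv τ (ΠiE {M = M} d t) = subst (Deriv _) (sym (eraseM-renM τ (sub0i t) M)) (ΠiE (erase-Deriv τ d) t)
erase-Deriv τ {Γ} (ΠpI d) =
  ΠpI (subst (λ Γ' → Deriv Γ' _) (map-commute (eraseM-prenM τ (liftErasure τ) there there (λ _ → refl)) Γ)
             (erase-Deriv (liftErasure τ) d))
erase-Deriv τ (ΠpE {M = M} d Φ) =
  subst (Deriv _) (sym (eraseM-psubM (liftErasure τ) τ (sub0 Φ) (sub0 (erase τ Φ)) (ErasedSub-sub0 τ Φ) M))
        (ΠpE (erase-Deriv τ d) (erase τ Φ))

eraseProblems : ∀ {Δ} → Erasure Δ Δ
eraseProblems {s = C} x = just x
eraseProblems {s = I} x = nothing

-- The problem axioms erase to the corresponding c-axioms, the specific axioms of QHC to instances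
-- of A ⊃ A, A ⇔ A and ¬⊥, and its rules to M ⇒ M.
erase𝒟 : ∀ {Δ n} {Γ : List (MF Δ n)} → Has𝒟 Γ → Deriv Γ (eraseM eraseProblems 𝒟)
erase𝒟 h = ⋀-intro {Ms = map (eraseM eraseProblems) axioms𝒟} (ax 0)
  ( ax 19 ∷ ax 20 ∷ ax 21 ∷ ax 22 ∷ ax 23 ∷ ax 24 ∷ ax 25 ∷ ax 26 ∷ ax 27
  ∷ ax 28 ∷ ax 29 ∷ ax 30 ∷ ax 31 ∷ ax 32 ∷ ax 33 ∷ ax 34 ∷ ax 35 ∷ ax 36
  ∷ ax 19 ∷ ax 20 ∷ ax 21 ∷ ax 22 ∷ ax 23 ∷ ax 24 ∷ ax 25 ∷ ax 26 ∷ ax 27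
  ∷ ax 28 ∷ ax 29 ∷ ax 30 ∷ ax 31 ∷ ax 32 ∷ ax 33 ∷ ax 34 ∷ ax 35 ∷ ax 36
  ∷ ax 37 ∷ ax 38 ∷ ax 39
  ∷ ΠpI (ΠpI (⇔-refl h₂ _))
  ∷ ΠpI (ΠpI (⇔-refl h₂ _))
  ∷ ΠpI (ΠpI (⊃-refl h₂ _))
  ∷ ¬ᶜ⊥ᶜ h
  ∷ ΠpI (⇔-refl h₁ _)
  ∷ ΠpI (⊃-refl h₁ _)
  ∷ ΠpI (⊃-refl h₁ _)
  ∷ ⊃-refl h _
  ∷ ΠpI (⊃-refl h₁ _)
  ∷ ΠpI (⊃-refl h₁ _)
  ∷ ΠpI (ΠpI (⊃-refl h₂ _))
  ∷ ΠpI (⇒I (hyp (here refl)))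
  ∷ ΠpI (⇒I (hyp (here refl)))
  ∷ [])
  where
  open Axioms h using (ax)
  open Propositional using (⇔-refl; ⊃-refl; ¬ᶜ⊥ᶜ)
  h₁ : ∀ {y} → Has𝒟 (map (prenM (there {y = y})) _)
  h₁ = Has𝒟-prenM h
  h₂ : ∀ {y y'} → Has𝒟 (map (prenM (there {y = y'})) (map (prenM (there {y = y})) _))
  h₂ = Has𝒟-prenM h₁

-- □◇ erases to ¬¬.
erase-◇-QC : ∀ {Δ n} {A : Fm C Δ n} → IsQC A → ∀ {Γ : List (MF Δ n)} → Has𝒟 Γ →
             Γ ⊢ erase eraseProblems (A ◇) ⇔' A
erase-◇-QC ⊤ᶜ          h = QHC.⇔-refl h _
erase-◇-QC ⊥ᶜ          h = QHC.⇔-refl h _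
erase-◇-QC (atom x ts) h = QHC.¬¬ᶜ-⇔ h _
erase-◇-QC (bin o a b) h =
  QHC.⇔-trans h (QHC.¬¬ᶜ-⇔ h _) (QHC.bin-cong h o (erase-◇-QC a h) (erase-◇-QC b h))
erase-◇-QC (¬ᶜ a)      h = QHC.⇔-trans h (QHC.¬¬ᶜ-⇔ h _) (QHC.¬ᶜ-cong h (erase-◇-QC a h))
erase-◇-QC (all a)     h = QHC.⇔-trans h (QHC.¬¬ᶜ-⇔ h _) (QHC.∀-cong h (erase-◇-QC a (Has𝒟-renM h)))
erase-◇-QC (ex a)      h = QHC.⇔-trans h (QHC.¬¬ᶜ-⇔ h _) (QHC.∃-cong h (erase-◇-QC a (Has𝒟-renM h)))

◇-reflects-⊢QHC-on-QC : ∀ {Δ n} (A : Fm C Δ n) → IsQC A → ⊢ᴰ (fm (A ◇)) → ⊢ᴰ (fm A)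
◇-reflects-⊢QHC-on-QC A qc d =
  ⇒I (mp h (⇔-to h (erase-◇-QC qc h)) (⇒E (Deriv-weaken (λ ()) (erase-Deriv eraseProblems d)) (erase𝒟 h)))
  where
  open Propositional using (mp; ⇔-to)
  h = here refl

mainTheorem5 :
    (∀ {Δ : PCtx} {n : ℕ} {s : Sort} (As : List (AnyFm Δ n)) (A : Fm s Δ n) →
       As ⊢QHC A → map ◇Σ As ⊢QHC (A ◇))
    ×
    (∀ {Δ : PCtx} {n : ℕ} (A : Fm C Δ n) →
       IsQC A → ⊢ᴰ (fm (A ◇)) → ⊢ᴰ (fm A))
mainTheorem5 = ◇-preserves-⊢QHC , ◇-reflects-⊢QHC-on-QC
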